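{- Let $p\ge 4$ and $q$ be integers with $\binom{p}{\lfloor p/2\rfloor}\ge q> 1+\binom{p-1}{\lfloor (p-1)/2\rfloor}$. Let $D$ be an optimal orientation of $K(2,p,q)$ with $d(D)=2$, where the partite sets are $V_1=\{1_1,1_2\}$, $V_2=\{2_1,\ldots,2_p\}$, $V_3=\{3_1,\ldots,3_q\}$. Then in $D$: (i) for exactly one $i\in\{1,2\}$ we have $1_i\rightarrow V_2\rightarrow 1_{3-i}\rightarrow V_3\rightarrow 1_i$; (ii) $\{O(3_i)\cap V_2 : i=1,2,\ldots,q\}$ is a family of pairwise independent subsets of $\{2_1,\ldots,2_p\}$. In particular, in the case $q=\binom{p}{\lfloor p/2\rfloor}$ there are at most two optimal orientations of $K(2,p,q)$ up to isomorphism.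
   Context: $K(2,p,q)$ is the complete tripartite graph with partite sets $V_1,V_2,V_3$ of sizes $2,p,q$. For a digraph $D$, $O(v)=\{x: v\to x\}$ is the outset of $v$; for vertex sets $X,Y$ (or single vertices), $X\rightarrow Y$ means $x\to y$ is an arc for every $x\in X$, $y\in Y$, and a chain $X\rightarrow Y\rightarrow Z$ means $X\rightarrow Y$ and $Y\rightarrow Z$. The diameter $d(D)$ of a digraph is the maximum over ordered pairs of vertices of the length of a shortest directed path. The orientation number $\bar d(G)$ is the minimum diameter over all strong orientations of $G$, and an orientation $D$ of $G$ is optimal if it is strong and $d(D)=\bar d(G)$. Two sets $S,T$ are independent if $S\not\subseteq T$ and $T\not\subseteq S$. -}

module Defs where

open import Data.Nat using (ℕ; zero; suc; _≤_)
open import Data.Fin using (Fin; zero; suc)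
open import Data.Bool using (Bool; true; false)
open import Data.Product using (Σ; _×_; ∃)
open import Data.Empty using (⊥)
open import Relation.Nullary using (¬_)
open import Relation.Binary.PropositionalEquality using (_≡_; _≢_)
open import Function.Bundles using (_↔_; Inverse)

-- Vertices of K(2,p,q): 1_i (i ∈ Fin 2), 2_a (a ∈ Fin p), 3_b (b ∈ Fin q)
data V (p q : ℕ) : Set where
  v1 : Fin 2 → V p q
  v2 : Fin p → V p q
  v3 : Fin q → V p q

part : ∀ {p q} → V p q → Fin 3
part (v1 _) = zero
part (v2 _) = suc zero
part (v3 _) = suc (suc zero)

Adj : ∀ {p q} → V p q → V p q → Set
Adj x y = part x ≢ part y

Digraph : ℕ → ℕ → Set
Digraph p q = V p q → V p q → Bool

Arc : ∀ {p q} → Digraph p q → V p q → V p q → Set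
Arc D x y = D x y ≡ true

record IsOrientation {p q : ℕ} (D : Digraph p q) : Set where
  field
    noArc   : ∀ x y → ¬ Adj x y → ¬ Arc D x y
    oneDir  : ∀ x y → Adj x y → Arc D x y → ¬ Arc D y x
    someDir : ∀ x y → Adj x y → ¬ Arc D x y → Arc D y x

-- there is a directed walk (equivalently path) of length ≤ k from x to y
data Within {p q : ℕ} (D : Digraph p q) : ℕ → V p q → V p q → Set where
  here : ∀ {k x} → Within D k x x
  step : ∀ {k x y z} → Arc D x y → Within D k y z → Within D (suc k) x z

AllWithin : ∀ {p q} → Digraph p q → ℕ → Set
AllWithin D k = ∀ x y → Within D k x y

Strong : ∀ {p q} → Digraph p q → Set
Strong D = ∃ λ k → AllWithin D k

-- d(D) = d : d is the least bound on all distances (= max of shortest distances)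
HasDiam : ∀ {p q} → Digraph p q → ℕ → Set
HasDiam D d = AllWithin D d × (∀ e → AllWithin D e → d ≤ e)

Optimal : ∀ {p q} → Digraph p q → Set
Optimal {p} {q} D = IsOrientation D × Σ ℕ λ d → HasDiam D d ×
  (∀ (D' : Digraph p q) d' → IsOrientation D' → HasDiam D' d' → d ≤ d')

Iso : ∀ {p q} → Digraph p q → Digraph p q → Set
Iso {p} {q} D E = Σ (V p q ↔ V p q) λ f →
  ∀ x y → D x y ≡ E (Inverse.to f x) (Inverse.to f y)

other : Fin 2 → Fin 2
other zero = suc zero
other (suc _) = zero

Pattern : ∀ {p q} → Digraph p q → Fin 2 → Set
Pattern {p} {q} D i =
  (∀ (a : Fin p) → Arc D (v1 i) (v2 a)) ×
  (∀ (a : Fin p) → Arc D (v2 a) (v1 (other i))) ×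
  (∀ (b : Fin q) → Arc D (v1 (other i)) (v3 b)) ×
  (∀ (b : Fin q) → Arc D (v3 b) (v1 i))

_⊆₂_ : ∀ {p} → (Fin p → Set) → (Fin p → Set) → Set
S ⊆₂ T = ∀ a → S a → T a

Independent : ∀ {p} → (Fin p → Set) → (Fin p → Set) → Set
Independent S T = ¬ (S ⊆₂ T) × ¬ (T ⊆₂ S)

OutV2 : ∀ {p q} → Digraph p q → Fin q → Fin p → Set
OutV2 D b a = Arc D (v3 b) (v2 a)

-- For a vertex 3_b let T b = O(3_b) ∩ V₂. In an orientation of diameter two, the vertices 3_b
-- with an arc to 1_i only have traces T b that form an antichain on the vertices 2_a with an arc
-- from 1_i only. Sperner's theorem bounds the number of such 3_b, and the bound
-- q > 1 + C(p-1, ⌊(p-1)/2⌋) leaves only the configuration in which one 1_i sends arcs to all of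
-- V₂ and receives arcs from all of V₃; this is (i), and then distinct 3_b must be separated
-- inside V₂, which is (ii).
-- If q = C(p, ⌊p/2⌋), the orientation whose T enumerates the ⌊p/2⌋-subsets of V₂ has diameter
-- two, so every optimal orientation does, and its family T is a maximum antichain. The equality
-- case of the LYM inequality makes T a full layer of size ⌊p/2⌋ or ⌈p/2⌉, and an optimal
-- orientation is determined up to isomorphism by this size.

module Submission where

open import Defs
open import Data.Nat using (ℕ; _≤_; _<_; _+_; _∸_; _/_)
open import Data.Nat.Combinatorics using (_C_)
open import Data.Fin using (Fin)
open import Data.Product using (Σ; _×_)
open import Data.Sum using (_⊎_)
open import Relation.Binary.PropositionalEquality using (_≡_; _≢_)

open import Axiom.UniquenessOfIdentityProofs using (module Decidable⇒UIP)
open import Data.Bool using (Bool; true; false; _∧_; _∨_; not; if_then_else_)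
open import Data.Bool.Properties
  using (∧-conicalˡ; ∧-conicalʳ; ∧-zeroʳ; ∧-identityʳ; ∧-comm; ∨-zeroʳ; ∨-identityʳ; not-involutive; not-¬; ¬-not)
  renaming (_≟_ to _≟ᵇ_)
open import Data.Empty using (⊥; ⊥-elim)
open import Data.Fin using (zero; suc; fromℕ<; splitAt; _↑ˡ_; _↑ʳ_)
open import Data.Fin.Properties using (any?; splitAt-↑ˡ; splitAt-↑ʳ; splitAt⁻¹-↑ˡ; splitAt⁻¹-↑ʳ)
  renaming (_≟_ to _≟ᶠ_; suc-injective to Fin-suc-injective)
open import Data.Nat using (zero; suc; pred; _*_; z≤n; s≤s; s≤s⁻¹; _!; ⌊_/2⌋; ⌈_/2⌉; NonZero; >-nonZero)
open import Data.Nat.Combinatorics using (nCk≡n!/k![n-k]!; k![n∸k]!∣n!; nCk+nC[k+1]≡[n+1]C[k+1])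
open import Data.Nat.DivMod using (m/n*n≡m; m/n≡1+[m∸n]/n)
open import Data.Nat.Properties
open import Data.Nat.Tactic.RingSolver using (solve-∀)
open import Algebra.Properties.Semiring.Sum +-*-semiring
  using (sum; sum-syntax; sum-cong-≗; ∑-distrib-+; ∑-comm; *-distribˡ-sum; sum-replicate-zero)
open import Data.Product using (_,_; ∃; proj₁; proj₂)
open import Data.Sum using (inj₁; inj₂)
import Data.Sum as Sum
open import Function.Bundles using (Inverse; mk↔ₛ′)
open import Relation.Nullary using (¬_; yes; no; does; Dec)
open import Relation.Nullary.Decidable using (_×-dec_)
open import Relation.Binary.PropositionalEquality
  using (refl; sym; trans; cong; cong₂; subst; subst₂; subst-sym-subst; subst-injective; ≢-sym; _≗_; module ≡-Reasoning)

true≢false : ∀ {b} → b ≡ true → b ≢ false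
true≢false = not-¬

not≡true : ∀ {b} → not b ≡ true → b ≡ false
not≡true {false} _ = refl

≢true : ∀ {b} → b ≢ true → b ≡ false
≢true = ¬-not

≢false : ∀ {b} → b ≢ false → b ≡ true
≢false = ¬-not

sum-mono-≤ : ∀ {n} {f g : Fin n → ℕ} → (∀ i → f i ≤ g i) → sum f ≤ sum g
sum-mono-≤ {zero} f≤g = z≤n
sum-mono-≤ {suc n} f≤g = +-mono-≤ (f≤g zero) (sum-mono-≤ (λ i → f≤g (suc i)))

sum-zero : ∀ {n} {f : Fin n → ℕ} → (∀ i → f i ≡ 0) → sum f ≡ 0
sum-zero {n} f≡0 = trans (sum-cong-≗ f≡0) (sum-replicate-zero n)

sum-single : ∀ {n} (f : Fin n → ℕ) b → (∀ i → i ≢ b → f i ≡ 0) → sum f ≡ f b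
sum-single f zero f≡0 =
  trans (cong (f zero +_) (sum-zero (λ i → f≡0 (suc i) (λ ())))) (+-identityʳ (f zero))
sum-single f (suc b) f≡0 =
  trans (cong (_+ sum (λ i → f (suc i))) (f≡0 zero (λ ())))
        (sum-single (λ i → f (suc i)) b (λ i i≢b → f≡0 (suc i) (λ e → i≢b (Fin-suc-injective e))))

sum-pos⇒∃ : ∀ {n} (f : Fin n → ℕ) → 0 < sum f → ∃ λ i → 0 < f i
sum-pos⇒∃ {suc n} f 0<sum with f zero in eq
... | suc _ = zero , subst (0 <_) (sym eq) (s≤s z≤n)
... | zero with sum-pos⇒∃ (λ i → f (suc i)) 0<sum
...   | i , 0<fi = suc i , 0<fi

≤-pointwise∧sum-≥⇒≡ : ∀ {n} (f g : Fin n → ℕ) → (∀ i → f i ≤ g i) → sum g ≤ sum f → ∀ i → f i ≡ g i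
≤-pointwise∧sum-≥⇒≡ f g f≤g g≤f zero = ≤-antisym (f≤g zero)
  (+-cancelʳ-≤ _ (g zero) (f zero)
    (≤-trans (+-monoʳ-≤ (g zero) (sum-mono-≤ (λ i → f≤g (suc i)))) g≤f))
≤-pointwise∧sum-≥⇒≡ f g f≤g g≤f (suc i) =
  ≤-pointwise∧sum-≥⇒≡ (λ i → f (suc i)) (λ i → g (suc i)) (λ i → f≤g (suc i))
    (+-cancelˡ-≤ (f zero) _ _ (≤-trans (+-monoˡ-≤ _ (f≤g zero)) g≤f)) i

Subset : ℕ → Set
Subset n = Fin n → Bool

⊤ₛ : ∀ {n} → Subset n
⊤ₛ _ = true

⊥ₛ : ∀ {n} → Subset n
⊥ₛ _ = false

⁅_⁆ : ∀ {n} → Fin n → Subset n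
⁅ x ⁆ a = does (a ≟ᶠ x)

∁ : ∀ {n} → Subset n → Subset n
∁ A a = not (A a)

_∩_ : ∀ {n} → Subset n → Subset n → Subset n
(A ∩ B) a = A a ∧ B a

_∪_ : ∀ {n} → Subset n → Subset n → Subset n
(A ∪ B) a = A a ∨ B a

_─_ : ∀ {n} → Subset n → Fin n → Subset n
A ─ x = A ∩ ∁ ⁅ x ⁆

_◂_ : ∀ {n} → Bool → Subset n → Subset (suc n)
(b ◂ A) zero = b
(b ◂ A) (suc i) = A i

tail : ∀ {n} → Subset (suc n) → Subset n
tail A i = A (suc i)

_⊆_ : ∀ {n} → Subset n → Subset n → Set
A ⊆ B = ∀ a → A a ≡ true → B a ≡ true

∣_∣ : ∀ {n} → Subset n → ℕ
∣_∣ {n} A = ∑[ a < n ] (if A a then 1 else 0)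

x∈⁅x⁆ : ∀ {n} (x : Fin n) → ⁅ x ⁆ x ≡ true
x∈⁅x⁆ x with x ≟ᶠ x
... | yes _ = refl
... | no x≢x = ⊥-elim (x≢x refl)

y∉⁅x⁆ : ∀ {n} {x y : Fin n} → y ≢ x → ⁅ x ⁆ y ≡ false
y∉⁅x⁆ {x = x} {y} y≢x with y ≟ᶠ x
... | yes y≡x = ⊥-elim (y≢x y≡x)
... | no _ = refl

x∉A─x : ∀ {n} (A : Subset n) x → (A ─ x) x ≡ false
x∉A─x A x = trans (cong (λ b → A x ∧ not b) (x∈⁅x⁆ x)) (∧-zeroʳ (A x))

A─x≡A : ∀ {n} (A : Subset n) {x y} → y ≢ x → (A ─ x) y ≡ A y
A─x≡A A {y = y} y≢x = trans (cong (λ b → A y ∧ not b) (y∉⁅x⁆ y≢x)) (∧-identityʳ (A y))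

sum-if-const : ∀ {n} (S : Subset n) c → ∑[ a < n ] (if S a then c else 0) ≡ c * ∣ S ∣
sum-if-const {n} S c = sym (trans (*-distribˡ-sum c (λ a → if S a then 1 else 0)) (sum-cong-≗ (λ a → c*if (S a))))
  where
  c*if : ∀ s → c * (if s then 1 else 0) ≡ (if s then c else 0)
  c*if true = *-identityʳ c
  c*if false = *-zeroʳ c

∣∣-cong : ∀ {n} {A B : Subset n} → (∀ a → A a ≡ B a) → ∣ A ∣ ≡ ∣ B ∣
∣∣-cong A≡B = sum-cong-≗ (λ a → cong (if_then 1 else 0) (A≡B a))

∣⊤ₛ∣ : ∀ n → ∣ ⊤ₛ {n} ∣ ≡ n
∣⊤ₛ∣ zero = refl
∣⊤ₛ∣ (suc n) = cong suc (∣⊤ₛ∣ n)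

∣⊥ₛ∣ : ∀ n → ∣ ⊥ₛ {n} ∣ ≡ 0
∣⊥ₛ∣ n = sum-replicate-zero n

∣∩∣+∣∩∁∣ : ∀ {n} (M A : Subset n) → ∣ M ∩ A ∣ + ∣ M ∩ ∁ A ∣ ≡ ∣ M ∣
∣∩∣+∣∩∁∣ M A = trans (sym (∑-distrib-+ (λ a → if (M ∩ A) a then 1 else 0) (λ a → if (M ∩ ∁ A) a then 1 else 0)))
                      (sum-cong-≗ (λ a → split (M a) (A a)))
  where
  split : ∀ m b → (if m ∧ b then 1 else 0) + (if m ∧ not b then 1 else 0) ≡ (if m then 1 else 0)
  split true true = refl
  split true false = refl
  split false b = refl

∣∩∣≤ : ∀ {n} (M A : Subset n) → ∣ M ∩ A ∣ ≤ ∣ M ∣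
∣∩∣≤ M A = subst (∣ M ∩ A ∣ ≤_) (∣∩∣+∣∩∁∣ M A) (m≤m+n _ _)

∣∩∣<∣∣ : ∀ {n} (M A : Subset n) x → M x ≡ true → A x ≡ false → ∣ M ∩ A ∣ < ∣ M ∣
∣∩∣<∣∣ {suc n} M A zero Mx Ax rewrite Mx | Ax = s≤s (∣∩∣≤ (tail M) (tail A))
∣∩∣<∣∣ {suc n} M A (suc x) Mx Ax =
  +-mono-≤-< (ind-∧ (M zero) (A zero)) (∣∩∣<∣∣ (tail M) (tail A) x Mx Ax)
  where
  ind-∧ : ∀ m b → (if m ∧ b then 1 else 0) ≤ (if m then 1 else 0)
  ind-∧ true true = ≤-refl
  ind-∧ true false = z≤n
  ind-∧ false b = z≤n

⊆⇒∣∩∣≡ : ∀ {n} (M A : Subset n) → M ⊆ A → ∣ M ∩ A ∣ ≡ ∣ M ∣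
⊆⇒∣∩∣≡ M A M⊆A = ∣∣-cong (λ a → ∩-id (M a) (A a) (M⊆A a))
  where
  ∩-id : ∀ m b → (m ≡ true → b ≡ true) → m ∧ b ≡ m
  ∩-id true b m⇒b = m⇒b refl
  ∩-id false b _ = refl

∣∩∣<⇒∃ : ∀ {n} (M A : Subset n) → ∣ M ∩ A ∣ < ∣ M ∣ → ∃ λ x → M x ≡ true × A x ≡ false
∣∩∣<⇒∃ {suc n} M A lt with M zero in Mz | A zero in Az
... | true | false = zero , Mz , Az
... | true | true with ∣∩∣<⇒∃ (tail M) (tail A) (+-cancelˡ-< 1 _ _ lt)
...   | x , Mx , Ax = suc x , Mx , Ax
∣∩∣<⇒∃ {suc n} M A lt | false | _ with ∣∩∣<⇒∃ (tail M) (tail A) lt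
...   | x , Mx , Ax = suc x , Mx , Ax

∣∩∣≡⇒⊆ : ∀ {n} (M A : Subset n) → ∣ M ∩ A ∣ ≡ ∣ M ∣ → M ⊆ A
∣∩∣≡⇒⊆ M A eq a Ma = ≢false (λ Aa → <-irrefl eq (∣∩∣<∣∣ M A a Ma Aa))

∣∣-pos⇒∃ : ∀ {n} (A : Subset n) → 0 < ∣ A ∣ → ∃ λ x → A x ≡ true
∣∣-pos⇒∃ A pos with sum-pos⇒∃ _ pos
... | x , 0<1 = x , ≢false (λ Ax → <-irrefl (sym (cong (if_then 1 else 0) Ax)) 0<1)

≡⊥ₛ⇒∣∣≡0 : ∀ {n} (A : Subset n) → (∀ x → A x ≡ false) → ∣ A ∣ ≡ 0
≡⊥ₛ⇒∣∣≡0 A A≡⊥ = sum-zero (λ x → cong (if_then 1 else 0) (A≡⊥ x))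

∣∩⁅x⁆∣ : ∀ {n} (M : Subset n) x → M x ≡ true → ∣ M ∩ ⁅ x ⁆ ∣ ≡ 1
∣∩⁅x⁆∣ M x Mx = trans (sum-single _ x (λ i i≢x →
    cong (if_then 1 else 0) (trans (cong (M i ∧_) (y∉⁅x⁆ i≢x)) (∧-zeroʳ (M i)))))
  (cong₂ (λ m b → if m ∧ b then 1 else 0) Mx (x∈⁅x⁆ x))

∣∣≡0⇒≡⊥ₛ : ∀ {n} (A : Subset n) → ∣ A ∣ ≡ 0 → ∀ x → A x ≡ false
∣∣≡0⇒≡⊥ₛ A eq x = ≢true (λ Ax → n≮0 (subst₂ _≤_ (∣∩⁅x⁆∣ A x Ax) eq (∣∩∣≤ A ⁅ x ⁆)))

∣─∣ : ∀ {n} (M : Subset n) x → M x ≡ true → suc ∣ M ─ x ∣ ≡ ∣ M ∣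
∣─∣ M x Mx = trans (cong (_+ ∣ M ─ x ∣) (sym (∣∩⁅x⁆∣ M x Mx))) (∣∩∣+∣∩∁∣ M ⁅ x ⁆)

∣∪⁅x⁆∣ : ∀ {n} (B : Subset n) x → B x ≡ false → ∣ B ∪ ⁅ x ⁆ ∣ ≡ suc ∣ B ∣
∣∪⁅x⁆∣ B x Bx = begin
  ∣ B ∪ ⁅ x ⁆ ∣               ≡⟨ sym (∣─∣ (B ∪ ⁅ x ⁆) x x∈B∪⁅x⁆) ⟩
  suc ∣ (B ∪ ⁅ x ⁆) ─ x ∣     ≡⟨ cong suc (∣∣-cong drop-x) ⟩
  suc ∣ B ∣                   ∎
  where
  open ≡-Reasoning
  x∈B∪⁅x⁆ : (B ∪ ⁅ x ⁆) x ≡ true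
  x∈B∪⁅x⁆ = trans (cong (B x ∨_) (x∈⁅x⁆ x)) (∨-zeroʳ (B x))
  drop-x : ∀ a → ((B ∪ ⁅ x ⁆) ─ x) a ≡ B a
  drop-x a with a ≟ᶠ x
  ... | yes refl = trans (∧-zeroʳ _) (sym Bx)
  ... | no _ = trans (∧-identityʳ _) (∨-identityʳ (B a))

∃-subset-of-size : ∀ {n} (S : Subset n) k → k ≤ ∣ S ∣ → ∃ λ A → ∣ A ∣ ≡ k × A ⊆ S
∃-subset-of-size {n} S zero _ = ⊥ₛ , ∣⊥ₛ∣ n , λ _ ()
∃-subset-of-size {suc n} S (suc k) k<∣S∣ with S zero in Sz
... | true with ∃-subset-of-size (tail S) k (s≤s⁻¹ k<∣S∣)
...   | A , ∣A∣ , A⊆S = true ◂ A , cong suc ∣A∣ , λ { zero _ → Sz ; (suc a) → A⊆S a }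
∃-subset-of-size {suc n} S (suc k) k<∣S∣ | false with ∃-subset-of-size (tail S) (suc k) k<∣S∣
...   | A , ∣A∣ , A⊆S = false ◂ A , ∣A∣ , λ { zero () ; (suc a) → A⊆S a }

∣∣≤1 : ∀ {n} (S : Subset n) → (∀ b c → S b ≡ true → S c ≡ true → b ≡ c) → ∣ S ∣ ≤ 1
∣∣≤1 S unique with ∣ S ∣ in eq
... | zero = z≤n
... | suc _ with ∣∣-pos⇒∃ S (subst (0 <_) (sym eq) (s≤s z≤n))
...   | b , Sb = ≤-reflexive (trans (sym eq) (trans (sum-single _ b only-b) (cong (if_then 1 else 0) Sb)))
  where
  only-b : ∀ i → i ≢ b → (if S i then 1 else 0) ≡ 0
  only-b i i≢b = cong (if_then 1 else 0) (≢true (λ Si → i≢b (unique i b Si Sb)))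

-- The LYM inequality

weight : ℕ → ℕ → ℕ
weight m t = t ! * (m ∸ t) !

IsAntichainOn : ∀ {n q} → Subset n → Subset q → (Fin q → Subset n) → Set
IsAntichainOn M sel T = ∀ b c → sel b ≡ true → sel c ≡ true → b ≢ c →
  ∃ λ a → M a ≡ true × T b a ≡ true × T c a ≡ false

-- m! times the Lubell sum  ∑ 1 / (m choose ∣M ∩ T b∣)  over the selected b, for m = ∣M∣.
lubellSum : ∀ {n q} → ℕ → Subset n → Subset q → (Fin q → Subset n) → ℕ
lubellSum {q = q} m M sel T = ∑[ b < q ] (if sel b then weight m ∣ M ∩ T b ∣ else 0)

avoiding : ∀ {n q} → Subset q → (Fin q → Subset n) → Fin n → Subset q
avoiding sel T x b = sel b ∧ not (T b x)

HasFullTrace : ∀ {n q} → ℕ → Subset n → Subset q → (Fin q → Subset n) → Set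
HasFullTrace m M sel T = ∃ λ b → sel b ≡ true × ∣ M ∩ T b ∣ ≡ m

hasFullTrace? : ∀ {n q} m (M : Subset n) (sel : Subset q) (T : Fin q → Subset n) →
  Dec (HasFullTrace m M sel T)
hasFullTrace? m M sel T = any? (λ b → (sel b ≟ᵇ true) ×-dec (∣ M ∩ T b ∣ ≟ m))

full⇒unselected : ∀ {n q} (M : Subset n) (sel : Subset q) (T : Fin q → Subset n) →
  IsAntichainOn M sel T → ∀ b → sel b ≡ true → ∣ M ∩ T b ∣ ≡ ∣ M ∣ → ∀ c → c ≢ b → sel c ≡ false
full⇒unselected M sel T anti b sb full c c≢b = ≢true λ sc →
  let (a , Ma , _ , Tba) = anti c b sc sb c≢b in <-irrefl full (∣∩∣<∣∣ M (T b) a Ma Tba)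

lubellSum-full : ∀ {n q} m (M : Subset n) (sel : Subset q) (T : Fin q → Subset n) → ∣ M ∣ ≡ m →
  IsAntichainOn M sel T → HasFullTrace m M sel T → lubellSum m M sel T ≡ m !
lubellSum-full m M sel T ∣M∣ anti (b , sb , full) = begin
  lubellSum m M sel T                     ≡⟨ sum-single _ b (λ c c≢b → cong (if_then _ else 0) (only-b c c≢b)) ⟩
  (if sel b then weight m ∣ M ∩ T b ∣ else 0) ≡⟨ cong (λ s → if s then weight m ∣ M ∩ T b ∣ else 0) sb ⟩
  weight m ∣ M ∩ T b ∣                    ≡⟨ cong (weight m) full ⟩
  m ! * (m ∸ m) !                         ≡⟨ cong (λ z → m ! * z !) (n∸n≡0 m) ⟩
  m ! * 1                                 ≡⟨ *-identityʳ (m !) ⟩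
  m !                                     ∎
  where
  open ≡-Reasoning
  only-b = full⇒unselected M sel T anti b sb (trans full (sym ∣M∣))

lubellSum-nonfull₀ : ∀ {n q} (M : Subset n) (sel : Subset q) (T : Fin q → Subset n) → ∣ M ∣ ≡ 0 →
  ¬ HasFullTrace 0 M sel T → lubellSum 0 M sel T ≡ 0
lubellSum-nonfull₀ M sel T ∣M∣ nonfull = sum-zero unselected
  where
  unselected : ∀ b → (if sel b then weight 0 ∣ M ∩ T b ∣ else 0) ≡ 0
  unselected b with sel b in sb
  ... | false = refl
  ... | true = ⊥-elim (nonfull (b , sb , n≤0⇒n≡0 (subst (∣ M ∩ T b ∣ ≤_) ∣M∣ (∣∩∣≤ M (T b)))))

∣─∩∣ : ∀ {n} (M A : Subset n) x → A x ≡ false → ∣ (M ─ x) ∩ A ∣ ≡ ∣ M ∩ A ∣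
∣─∩∣ M A x Ax = ∣∣-cong same
  where
  same : ∀ a → (M ─ x) a ∧ A a ≡ M a ∧ A a
  same a with a ≟ᶠ x
  ... | yes refl rewrite Ax = trans (∧-zeroʳ _) (sym (∧-zeroʳ _))
  ... | no _ = cong (_∧ A a) (∧-identityʳ (M a))

antichain-─ : ∀ {n q} (M : Subset n) (sel : Subset q) (T : Fin q → Subset n) →
  IsAntichainOn M sel T → ∀ x → IsAntichainOn (M ─ x) (avoiding sel T x) T
antichain-─ M sel T anti x b c sb sc b≢c with anti b c (∧-conicalˡ _ _ sb) (∧-conicalˡ _ _ sc) b≢c
... | a , Ma , Tba , Tca = a , trans (A─x≡A M a≢x) Ma , Tba , Tca
  where
  a≢x : a ≢ x
  a≢x refl = true≢false Tba (not≡true (∧-conicalʳ _ _ sb))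

weight-step : ∀ m t → t ≤ m → (suc m ∸ t) * weight m t ≡ weight (suc m) t
weight-step m t t≤m = begin
  (suc m ∸ t) * (t ! * (m ∸ t) !)   ≡⟨ cong (_* (t ! * (m ∸ t) !)) (+-∸-assoc 1 t≤m) ⟩
  suc (m ∸ t) * (t ! * (m ∸ t) !)   ≡⟨ x*[y*z]≡y*[x*z] (suc (m ∸ t)) (t !) ((m ∸ t) !) ⟩
  t ! * (suc (m ∸ t) * (m ∸ t) !)   ≡⟨ cong (λ z → t ! * z !) (sym (+-∸-assoc 1 t≤m)) ⟩
  t ! * (suc m ∸ t) !               ∎
  where
  open ≡-Reasoning
  x*[y*z]≡y*[x*z] : ∀ x y z → x * (y * z) ≡ y * (x * z)
  x*[y*z]≡y*[x*z] = solve-∀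

if-then-sum : ∀ {n} s (f : Fin n → ℕ) → (if s then sum f else 0) ≡ ∑[ i < n ] (if s then f i else 0)
if-then-sum true f = refl
if-then-sum {n} false f = sym (sum-replicate-zero n)

∑-misses : ∀ {n} m (M A : Subset n) → ∣ M ∣ ≡ suc m → ∣ M ∩ A ∣ ≤ m →
  ∑[ x < n ] (if (M ∩ ∁ A) x then weight m ∣ M ∩ A ∣ else 0) ≡ weight (suc m) ∣ M ∩ A ∣
∑-misses {n} m M A ∣M∣ t≤m = begin
  ∑[ x < n ] (if (M ∩ ∁ A) x then weight m t else 0) ≡⟨ sum-if-const (M ∩ ∁ A) (weight m t) ⟩
  weight m t * ∣ M ∩ ∁ A ∣                       ≡⟨ cong (weight m t *_) ∣M∖A∣ ⟩
  weight m t * (suc m ∸ t)                       ≡⟨ *-comm (weight m t) _ ⟩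
  (suc m ∸ t) * weight m t                       ≡⟨ weight-step m t t≤m ⟩
  weight (suc m) t                               ∎
  where
  open ≡-Reasoning
  t = ∣ M ∩ A ∣
  ∣M∖A∣ : ∣ M ∩ ∁ A ∣ ≡ suc m ∸ t
  ∣M∖A∣ = trans (sym (m+n∸m≡n t _)) (cong (_∸ t) (trans (∣∩∣+∣∩∁∣ M A) ∣M∣))

-- Double counting the pairs (x, b) with x ∈ M ∖ T b.
lubellSum-decompose : ∀ {n q} m (M : Subset n) (sel : Subset q) (T : Fin q → Subset n) →
  ∣ M ∣ ≡ suc m → ¬ HasFullTrace (suc m) M sel T →
  lubellSum (suc m) M sel T ≡ ∑[ x < n ] (if M x then lubellSum m (M ─ x) (avoiding sel T x) T else 0)
lubellSum-decompose {n} {q} m M sel T ∣M∣ nonfull = sym (begin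
  ∑[ x < n ] (if M x then ∑[ b < q ] (if avoiding sel T x b then weight m ∣ (M ─ x) ∩ T b ∣ else 0) else 0)
    ≡⟨ sum-cong-≗ (λ x → if-then-sum {q} (M x) _) ⟩
  ∑[ x < n ] ∑[ b < q ] (if M x then (if avoiding sel T x b then weight m ∣ (M ─ x) ∩ T b ∣ else 0) else 0)
    ≡⟨ sum-cong-≗ (λ x → sum-cong-≗ (λ b → reorder x b)) ⟩
  ∑[ x < n ] ∑[ b < q ] (if sel b then (if (M ∩ ∁ (T b)) x then weight m ∣ M ∩ T b ∣ else 0) else 0)
    ≡⟨ ∑-comm (λ x b → if sel b then (if (M ∩ ∁ (T b)) x then weight m ∣ M ∩ T b ∣ else 0) else 0) ⟩
  ∑[ b < q ] ∑[ x < n ] (if sel b then (if (M ∩ ∁ (T b)) x then weight m ∣ M ∩ T b ∣ else 0) else 0)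
    ≡⟨ sum-cong-≗ (λ b → sym (if-then-sum {n} (sel b) _)) ⟩
  ∑[ b < q ] (if sel b then ∑[ x < n ] (if (M ∩ ∁ (T b)) x then weight m ∣ M ∩ T b ∣ else 0) else 0)
    ≡⟨ sum-cong-≗ count-misses ⟩
  lubellSum (suc m) M sel T ∎)
  where
  open ≡-Reasoning
  reorder : ∀ x b →
    (if M x then (if avoiding sel T x b then weight m ∣ (M ─ x) ∩ T b ∣ else 0) else 0) ≡
    (if sel b then (if (M ∩ ∁ (T b)) x then weight m ∣ M ∩ T b ∣ else 0) else 0)
  reorder x b with M x | sel b | T b x in Tbx
  ... | false | false | _ = refl
  ... | false | true | _ = refl
  ... | true | false | _ = refl
  ... | true | true | true = refl
  ... | true | true | false = cong (weight m) (∣─∩∣ M (T b) x Tbx)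
  count-misses : ∀ b →
    (if sel b then ∑[ x < n ] (if (M ∩ ∁ (T b)) x then weight m ∣ M ∩ T b ∣ else 0) else 0) ≡
    (if sel b then weight (suc m) ∣ M ∩ T b ∣ else 0)
  count-misses b with sel b in sb
  ... | false = refl
  ... | true = ∑-misses m M (T b) ∣M∣
    (s≤s⁻¹ (≤∧≢⇒< (subst (∣ M ∩ T b ∣ ≤_) ∣M∣ (∣∩∣≤ M (T b))) (λ eq → nonfull (b , sb , eq))))

lubellSum≤ : ∀ {n q} m (M : Subset n) (sel : Subset q) (T : Fin q → Subset n) → ∣ M ∣ ≡ m →
  IsAntichainOn M sel T → lubellSum m M sel T ≤ m !

lubellSum-─≤ : ∀ {n q} m (M : Subset n) (sel : Subset q) (T : Fin q → Subset n) → ∣ M ∣ ≡ suc m →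
  IsAntichainOn M sel T → ∀ x →
  (if M x then lubellSum m (M ─ x) (avoiding sel T x) T else 0) ≤ (if M x then m ! else 0)

lubellSum≤ m M sel T ∣M∣ anti with hasFullTrace? m M sel T
... | yes full = ≤-reflexive (lubellSum-full m M sel T ∣M∣ anti full)
lubellSum≤ zero M sel T ∣M∣ anti | no nonfull = ≤-trans (≤-reflexive (lubellSum-nonfull₀ M sel T ∣M∣ nonfull)) z≤n
lubellSum≤ {n} (suc m) M sel T ∣M∣ anti | no nonfull = begin
  lubellSum (suc m) M sel T
    ≡⟨ lubellSum-decompose m M sel T ∣M∣ nonfull ⟩
  ∑[ x < n ] (if M x then lubellSum m (M ─ x) (avoiding sel T x) T else 0)
    ≤⟨ sum-mono-≤ (lubellSum-─≤ m M sel T ∣M∣ anti) ⟩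
  ∑[ x < n ] (if M x then m ! else 0)
    ≡⟨ sum-if-const M (m !) ⟩
  m ! * ∣ M ∣
    ≡⟨ trans (cong (m ! *_) ∣M∣) (*-comm (m !) (suc m)) ⟩
  suc m ! ∎
  where open ≤-Reasoning

lubellSum-─≤ m M sel T ∣M∣ anti x with M x in Mx
... | false = z≤n
... | true = lubellSum≤ m (M ─ x) (avoiding sel T x) T
               (suc-injective (trans (∣─∣ M x Mx) ∣M∣)) (antichain-─ M sel T anti x)

-- Equality in the LYM inequality

AgreeOn : ∀ {n} → Subset n → Subset n → Subset n → Set
AgreeOn M A B = ∀ a → M a ≡ true → A a ≡ B a

record IsLayer {n q} (M : Subset n) (sel : Subset q) (T : Fin q → Subset n) (k : ℕ) : Set where
  field
    size     : ∀ b → sel b ≡ true → ∣ M ∩ T b ∣ ≡ k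
    complete : ∀ A → ∣ M ∩ A ∣ ≡ k → ∃ λ b → sel b ≡ true × AgreeOn M (T b) A

AgreeOn⇒∣∩∣≡ : ∀ {n} (M A B : Subset n) → AgreeOn M A B → ∣ M ∩ A ∣ ≡ ∣ M ∩ B ∣
AgreeOn⇒∣∩∣≡ M A B agree = ∣∣-cong same
  where
  same : ∀ a → M a ∧ A a ≡ M a ∧ B a
  same a with M a in Ma
  ... | true = agree a Ma
  ... | false = refl

AgreeOn-─ : ∀ {n} (M A B : Subset n) y → A y ≡ B y → AgreeOn (M ─ y) A B → AgreeOn M A B
AgreeOn-─ M A B y Ay≡By agree a Ma with a ≟ᶠ y
... | yes refl = Ay≡By
... | no a≢y = agree a (trans (A─x≡A M a≢y) Ma)

⊆⇒∣∩∣≡∣∣ : ∀ {n} (R A : Subset n) → A ⊆ R → ∣ R ∩ A ∣ ≡ ∣ A ∣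
⊆⇒∣∩∣≡∣∣ R A A⊆R = trans (∣∣-cong (λ a → ∧-comm (R a) (A a))) (⊆⇒∣∩∣≡ A R A⊆R)

full⇒layer : ∀ {n q} m (M : Subset n) (sel : Subset q) (T : Fin q → Subset n) → ∣ M ∣ ≡ m →
  IsAntichainOn M sel T → HasFullTrace m M sel T → IsLayer M sel T m
full⇒layer m M sel T ∣M∣ anti (b , sb , full) = record { size = size ; complete = complete }
  where
  full′ = trans full (sym ∣M∣)
  size : ∀ c → sel c ≡ true → ∣ M ∩ T c ∣ ≡ m
  size c sc with c ≟ᶠ b
  ... | yes refl = full
  ... | no c≢b = ⊥-elim (true≢false sc (full⇒unselected M sel T anti b sb full′ c c≢b))
  complete : ∀ A → ∣ M ∩ A ∣ ≡ m → ∃ λ c → sel c ≡ true × AgreeOn M (T c) A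
  complete A ∣M∩A∣ = b , sb , λ a Ma →
    trans (∣∩∣≡⇒⊆ M (T b) full′ a Ma) (sym (∣∩∣≡⇒⊆ M A (trans ∣M∩A∣ (sym ∣M∣)) a Ma))

lubellSum-─≡ : ∀ {n q} m (M : Subset n) (sel : Subset q) (T : Fin q → Subset n) → ∣ M ∣ ≡ suc m →
  IsAntichainOn M sel T → ¬ HasFullTrace (suc m) M sel T → lubellSum (suc m) M sel T ≡ suc m ! →
  ∀ x → M x ≡ true → lubellSum m (M ─ x) (avoiding sel T x) T ≡ m !
lubellSum-─≡ {n} m M sel T ∣M∣ anti nonfull eq x Mx =
  subst (λ s → (if s then L x else 0) ≡ (if s then m ! else 0)) Mx
    (≤-pointwise∧sum-≥⇒≡ (λ y → if M y then L y else 0) (λ y → if M y then m ! else 0)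
      (lubellSum-─≤ m M sel T ∣M∣ anti) sum≥ x)
  where
  L : Fin n → ℕ
  L y = lubellSum m (M ─ y) (avoiding sel T y) T
  sum≥ : ∑[ y < n ] (if M y then m ! else 0) ≤ ∑[ y < n ] (if M y then L y else 0)
  sum≥ = ≤-reflexive (begin
    ∑[ y < n ] (if M y then m ! else 0)  ≡⟨ sum-if-const M (m !) ⟩
    m ! * ∣ M ∣                          ≡⟨ trans (cong (m ! *_) ∣M∣) (*-comm (m !) (suc m)) ⟩
    suc m !                              ≡⟨ sym eq ⟩
    lubellSum (suc m) M sel T            ≡⟨ lubellSum-decompose m M sel T ∣M∣ nonfull ⟩
    ∑[ y < n ] (if M y then L y else 0)  ∎)
    where open ≡-Reasoning

module LayerGluing {n q} (m : ℕ) (M : Subset n) (sel : Subset q) (T : Fin q → Subset n)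
  (∣M∣ : ∣ M ∣ ≡ suc m) (nonfull : ¬ HasFullTrace (suc m) M sel T)
  (layer : ∀ x → M x ≡ true → Σ ℕ λ k → k ≤ m × IsLayer (M ─ x) (avoiding sel T x) T k) where

  k : ∀ x → M x ≡ true → ℕ
  k x Mx = proj₁ (layer x Mx)

  k≤m : ∀ x Mx → k x Mx ≤ m
  k≤m x Mx = proj₁ (proj₂ (layer x Mx))

  module L x Mx = IsLayer (proj₂ (proj₂ (layer x Mx)))

  ∣─∣≡m : ∀ x → M x ≡ true → ∣ M ─ x ∣ ≡ m
  ∣─∣≡m x Mx = suc-injective (trans (∣─∣ M x Mx) ∣M∣)

  avoiding-intro : ∀ {y b} → sel b ≡ true → T b y ≡ false → avoiding sel T y b ≡ true
  avoiding-intro {b = b} sb Tby = trans (cong (λ t → sel b ∧ not t) Tby) (trans (∧-identityʳ (sel b)) sb)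

  -- A k-subset of M ∖ {x, y} is a trace in both layers, which forces the two sizes to agree.
  k-agree< : ∀ x y (Mx : M x ≡ true) (My : M y ≡ true) → x ≢ y → k x Mx < m → k x Mx ≡ k y My
  k-agree< x y Mx My x≢y k<m = begin
    k x Mx                      ≡⟨ sym ∣M─x∩A∣ ⟩
    ∣ (M ─ x) ∩ A ∣             ≡⟨ sym (AgreeOn⇒∣∩∣≡ (M ─ x) (T b) A agree) ⟩
    ∣ (M ─ x) ∩ T b ∣           ≡⟨ ∣─∩∣ M (T b) x Tbx ⟩
    ∣ M ∩ T b ∣                 ≡⟨ sym (∣─∩∣ M (T b) y Tby) ⟩
    ∣ (M ─ y) ∩ T b ∣           ≡⟨ L.size y My b (avoiding-intro (∧-conicalˡ _ _ sb) Tby) ⟩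
    k y My                      ∎
    where
    open ≡-Reasoning
    R = (M ─ x) ─ y
    y∈M─x : (M ─ x) y ≡ true
    y∈M─x = trans (A─x≡A M (≢-sym x≢y)) My
    k≤∣R∣ : k x Mx ≤ ∣ R ∣
    k≤∣R∣ = s≤s⁻¹ (subst (suc (k x Mx) ≤_) (sym (trans (∣─∣ (M ─ x) y y∈M─x) (∣─∣≡m x Mx))) k<m)
    A = proj₁ (∃-subset-of-size R (k x Mx) k≤∣R∣)
    ∣A∣ = proj₁ (proj₂ (∃-subset-of-size R (k x Mx) k≤∣R∣))
    A⊆R = proj₂ (proj₂ (∃-subset-of-size R (k x Mx) k≤∣R∣))
    ∣M─x∩A∣ : ∣ (M ─ x) ∩ A ∣ ≡ k x Mx
    ∣M─x∩A∣ = trans (⊆⇒∣∩∣≡∣∣ (M ─ x) A (λ a Aa → ∧-conicalˡ _ _ (A⊆R a Aa))) ∣A∣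
    b = proj₁ (L.complete x Mx A ∣M─x∩A∣)
    sb = proj₁ (proj₂ (L.complete x Mx A ∣M─x∩A∣))
    agree = proj₂ (proj₂ (L.complete x Mx A ∣M─x∩A∣))
    Tbx : T b x ≡ false
    Tbx = not≡true (∧-conicalʳ _ _ sb)
    Tby : T b y ≡ false
    Tby = trans (agree y y∈M─x) (≢true (λ Ay → true≢false (A⊆R y Ay) (x∉A─x (M ─ x) y)))

  k-constant : ∀ x y (Mx : M x ≡ true) (My : M y ≡ true) → k x Mx ≡ k y My
  k-constant x y Mx My with x ≟ᶠ y
  ... | yes refl = cong (k x) (Decidable⇒UIP.≡-irrelevant _≟ᵇ_ Mx My)
  ... | no x≢y with k x Mx <? m | k y My <? m
  ...   | yes k<m | _ = k-agree< x y Mx My x≢y k<m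
  ...   | no _ | yes k<m = sym (k-agree< y x My Mx (≢-sym x≢y) k<m)
  ...   | no k≮m | no k′≮m = trans (≤-antisym (k≤m x Mx) (≮⇒≥ k≮m)) (sym (≤-antisym (k≤m y My) (≮⇒≥ k′≮m)))

  module _ (x₀ : Fin n) (Mx₀ : M x₀ ≡ true) where

    glued : IsLayer M sel T (k x₀ Mx₀)
    glued = record { size = size ; complete = complete }
      where
      size : ∀ b → sel b ≡ true → ∣ M ∩ T b ∣ ≡ k x₀ Mx₀
      size b sb = trans (sym (∣─∩∣ M (T b) y Tby)) (trans (L.size y My b (avoiding-intro sb Tby)) (k-constant y x₀ My Mx₀))
        where
        ∣M∩Tb∣<∣M∣ : ∣ M ∩ T b ∣ < ∣ M ∣
        ∣M∩Tb∣<∣M∣ = ≤∧≢⇒< (∣∩∣≤ M (T b)) (λ eq → nonfull (b , sb , trans eq ∣M∣))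
        y = proj₁ (∣∩∣<⇒∃ M (T b) ∣M∩Tb∣<∣M∣)
        My = proj₁ (proj₂ (∣∩∣<⇒∃ M (T b) ∣M∩Tb∣<∣M∣))
        Tby = proj₂ (proj₂ (∣∩∣<⇒∃ M (T b) ∣M∩Tb∣<∣M∣))
      complete : ∀ A → ∣ M ∩ A ∣ ≡ k x₀ Mx₀ → ∃ λ b → sel b ≡ true × AgreeOn M (T b) A
      complete A ∣M∩A∣ = b , ∧-conicalˡ _ _ sb , AgreeOn-─ M (T b) A y Tby≡Ay agree
        where
        ∣M∩A∣<∣M∣ : ∣ M ∩ A ∣ < ∣ M ∣
        ∣M∩A∣<∣M∣ = subst (∣ M ∩ A ∣ <_) (sym ∣M∣) (subst (_< suc m) (sym ∣M∩A∣) (s≤s (k≤m x₀ Mx₀)))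
        y = proj₁ (∣∩∣<⇒∃ M A ∣M∩A∣<∣M∣)
        My = proj₁ (proj₂ (∣∩∣<⇒∃ M A ∣M∩A∣<∣M∣))
        Ay = proj₂ (proj₂ (∣∩∣<⇒∃ M A ∣M∩A∣<∣M∣))
        found = L.complete y My A (trans (∣─∩∣ M A y Ay) (trans ∣M∩A∣ (k-constant x₀ y Mx₀ My)))
        b = proj₁ found
        sb = proj₁ (proj₂ found)
        agree = proj₂ (proj₂ found)
        Tby≡Ay : T b y ≡ A y
        Tby≡Ay = trans (not≡true (∧-conicalʳ _ _ sb)) (sym Ay)

lubellSum≡⇒layer : ∀ {n q} m (M : Subset n) (sel : Subset q) (T : Fin q → Subset n) → ∣ M ∣ ≡ m →
  IsAntichainOn M sel T → lubellSum m M sel T ≡ m ! → Σ ℕ λ k → k ≤ m × IsLayer M sel T k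
lubellSum≡⇒layer m M sel T ∣M∣ anti eq with hasFullTrace? m M sel T
... | yes full = m , ≤-refl , full⇒layer m M sel T ∣M∣ anti full
lubellSum≡⇒layer zero M sel T ∣M∣ anti eq | no nonfull =
  ⊥-elim (0≢1+n (trans (sym (lubellSum-nonfull₀ M sel T ∣M∣ nonfull)) eq))
lubellSum≡⇒layer (suc m) M sel T ∣M∣ anti eq | no nonfull =
  LayerGluing.k m M sel T ∣M∣ nonfull layer x₀ Mx₀ ,
  m≤n⇒m≤1+n (LayerGluing.k≤m m M sel T ∣M∣ nonfull layer x₀ Mx₀) ,
  LayerGluing.glued m M sel T ∣M∣ nonfull layer x₀ Mx₀
  where
  layer : ∀ x → M x ≡ true → Σ ℕ λ k → k ≤ m × IsLayer (M ─ x) (avoiding sel T x) T k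
  layer x Mx = lubellSum≡⇒layer m (M ─ x) (avoiding sel T x) T
    (suc-injective (trans (∣─∣ M x Mx) ∣M∣)) (antichain-─ M sel T anti x)
    (lubellSum-─≡ m M sel T ∣M∣ anti nonfull eq x Mx)
  x₀ = proj₁ (∣∣-pos⇒∃ M (subst (0 <_) (sym ∣M∣) (s≤s z≤n)))
  Mx₀ = proj₂ (∣∣-pos⇒∃ M (subst (0 <_) (sym ∣M∣) (s≤s z≤n)))

-- Central binomial coefficients and Sperner's theorem

∸≡suc[∸suc] : ∀ {m t} → t < m → m ∸ t ≡ suc (m ∸ suc t)
∸≡suc[∸suc] {suc m} {zero} _ = refl
∸≡suc[∸suc] {suc m} {suc t} (s≤s t<m) = ∸≡suc[∸suc] t<m

weight-suc : ∀ m t → t < m → weight m (suc t) * (m ∸ t) ≡ weight m t * suc t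
weight-suc m t t<m rewrite ∸≡suc[∸suc] t<m = rearrange t (t !) (m ∸ suc t) ((m ∸ suc t) !)
  where
  rearrange : ∀ t f d g → ((1 + t) * f) * g * (1 + d) ≡ f * ((1 + d) * g) * (1 + t)
  rearrange = solve-∀

weight-suc-< : ∀ m t → suc t + suc t ≤ m → weight m (suc t) < weight m t
weight-suc-< m t 2t+2≤m = *-cancelʳ-< _ (weight m (suc t)) (weight m t) (begin-strict
  weight m (suc t) * (m ∸ t)  ≡⟨ weight-suc m t (≤-trans (m≤m+n (suc t) (suc t)) 2t+2≤m) ⟩
  weight m t * suc t          <⟨ *-monoʳ-< (weight m t) {{weight-nonZero}} t+1<m-t ⟩
  weight m t * (m ∸ t)        ∎)
  where
  open ≤-Reasoning
  weight-nonZero : NonZero (weight m t)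
  weight-nonZero = t !* (m ∸ t) !≢0
  t+1<m-t : suc t < m ∸ t
  t+1<m-t = subst (_≤ m ∸ t) (m+n∸n≡m (suc (suc t)) t)
    (∸-monoˡ-≤ t (subst (_≤ m) (cong suc (+-suc t t)) 2t+2≤m))

weight-<-mono : ∀ m {t s} → t < s → s + s ≤ m → weight m s < weight m t
weight-<-mono m {t} {suc s} (s≤s t≤s) 2s+2≤m with m≤n⇒m<n∨m≡n t≤s
... | inj₂ refl = weight-suc-< m t 2s+2≤m
... | inj₁ t<s = <-trans (weight-suc-< m s 2s+2≤m)
                   (weight-<-mono m t<s (≤-trans (+-mono-≤ (n≤1+n s) (n≤1+n s)) 2s+2≤m))

weight-sym : ∀ m t → t ≤ m → weight m (m ∸ t) ≡ weight m t
weight-sym m t t≤m = trans (cong (λ z → (m ∸ t) ! * z !) (m∸[m∸n]≡n t≤m)) (*-comm ((m ∸ t) !) (t !))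

⌊n/2⌋+⌊n/2⌋≤n : ∀ n → ⌊ n /2⌋ + ⌊ n /2⌋ ≤ n
⌊n/2⌋+⌊n/2⌋≤n n = subst (⌊ n /2⌋ + ⌊ n /2⌋ ≤_) (⌊n/2⌋+⌈n/2⌉≡n n) (+-monoʳ-≤ ⌊ n /2⌋ (⌊n/2⌋≤⌈n/2⌉ n))

⌈n/2⌉≡⌊n/2⌋⊎1+⌊n/2⌋ : ∀ n → ⌈ n /2⌉ ≡ ⌊ n /2⌋ ⊎ ⌈ n /2⌉ ≡ suc ⌊ n /2⌋
⌈n/2⌉≡⌊n/2⌋⊎1+⌊n/2⌋ zero = inj₁ refl
⌈n/2⌉≡⌊n/2⌋⊎1+⌊n/2⌋ (suc zero) = inj₂ refl
⌈n/2⌉≡⌊n/2⌋⊎1+⌊n/2⌋ (suc (suc n)) with ⌈n/2⌉≡⌊n/2⌋⊎1+⌊n/2⌋ n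
... | inj₁ eq = inj₁ (cong suc eq)
... | inj₂ eq = inj₂ (cong suc eq)

n∸⌊n/2⌋≡⌈n/2⌉ : ∀ n → n ∸ ⌊ n /2⌋ ≡ ⌈ n /2⌉
n∸⌊n/2⌋≡⌈n/2⌉ n = trans (cong (_∸ ⌊ n /2⌋) (sym (⌊n/2⌋+⌈n/2⌉≡n n))) (m+n∸m≡n ⌊ n /2⌋ ⌈ n /2⌉)

/2≡⌊/2⌋ : ∀ n → n / 2 ≡ ⌊ n /2⌋
/2≡⌊/2⌋ zero = refl
/2≡⌊/2⌋ (suc zero) = refl
/2≡⌊/2⌋ (suc (suc n)) = trans (m/n≡1+[m∸n]/n {suc (suc n)} {2} (s≤s (s≤s z≤n))) (cong suc (/2≡⌊/2⌋ n))

⌈n/2⌉≤1+⌊n/2⌋ : ∀ n → ⌈ n /2⌉ ≤ suc ⌊ n /2⌋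
⌈n/2⌉≤1+⌊n/2⌋ n with ⌈n/2⌉≡⌊n/2⌋⊎1+⌊n/2⌋ n
... | inj₁ eq = ≤-trans (≤-reflexive eq) (n≤1+n _)
... | inj₂ eq = ≤-reflexive eq

weight-below-middle : ∀ m u → u ≤ ⌊ m /2⌋ → u ≡ ⌊ m /2⌋ ⊎ weight m ⌊ m /2⌋ < weight m u
weight-below-middle m u u≤h with m≤n⇒m<n∨m≡n u≤h
... | inj₂ u≡h = inj₁ u≡h
... | inj₁ u<h = inj₂ (weight-<-mono m u<h (⌊n/2⌋+⌊n/2⌋≤n m))

m∸t≤⌊m/2⌋ : ∀ m t → ⌊ m /2⌋ < t → m ∸ t ≤ ⌊ m /2⌋
m∸t≤⌊m/2⌋ m t h<t = m≤n+o⇒m∸n≤o m t (begin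
  m                           ≡⟨ sym (⌊n/2⌋+⌈n/2⌉≡n m) ⟩
  ⌊ m /2⌋ + ⌈ m /2⌉           ≤⟨ +-monoʳ-≤ ⌊ m /2⌋ (⌈n/2⌉≤1+⌊n/2⌋ m) ⟩
  ⌊ m /2⌋ + suc ⌊ m /2⌋       ≡⟨ +-comm ⌊ m /2⌋ _ ⟩
  suc ⌊ m /2⌋ + ⌊ m /2⌋       ≤⟨ +-monoˡ-≤ ⌊ m /2⌋ h<t ⟩
  t + ⌊ m /2⌋                 ∎)
  where open ≤-Reasoning

weight-central : ∀ m t → t ≤ m → (t ≡ ⌊ m /2⌋ ⊎ t ≡ ⌈ m /2⌉) ⊎ weight m ⌊ m /2⌋ < weight m t
weight-central m t t≤m with t ≤? ⌊ m /2⌋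
... | yes t≤h = Sum.map₁ inj₁ (weight-below-middle m t t≤h)
... | no t≰h with weight-below-middle m (m ∸ t) (m∸t≤⌊m/2⌋ m t (≰⇒> t≰h))
...   | inj₁ eq = inj₁ (inj₂ (trans (sym (m∸[m∸n]≡n t≤m)) (trans (cong (m ∸_) eq) (n∸⌊n/2⌋≡⌈n/2⌉ m))))
...   | inj₂ lt = inj₂ (subst (weight m ⌊ m /2⌋ <_) (weight-sym m t t≤m) lt)

weight-minimum : ∀ m t → t ≤ m → weight m ⌊ m /2⌋ ≤ weight m t
weight-minimum m t t≤m with weight-central m t t≤m
... | inj₁ (inj₁ refl) = ≤-refl
... | inj₁ (inj₂ refl) = ≤-reflexive (trans (sym (weight-sym m ⌊ m /2⌋ (⌊n/2⌋≤n m))) (cong (weight m) (n∸⌊n/2⌋≡⌈n/2⌉ m)))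
... | inj₂ lt = <⇒≤ lt

weight≡minimum⇒central : ∀ m t → t ≤ m → weight m t ≡ weight m ⌊ m /2⌋ → t ≡ ⌊ m /2⌋ ⊎ t ≡ ⌈ m /2⌉
weight≡minimum⇒central m t t≤m eq with weight-central m t t≤m
... | inj₁ central = central
... | inj₂ lt = ⊥-elim (<-irrefl (sym eq) lt)

C*weight≡! : ∀ m k → k ≤ m → (m C k) * weight m k ≡ m !
C*weight≡! m k k≤m = trans (cong (_* weight m k) (nCk≡n!/k![n-k]! k≤m)) (m/n*n≡m (k![n∸k]!∣n! k≤m))
  where instance _ = k !* (m ∸ k) !≢0

central-C-suc : ∀ m → m C ⌊ m /2⌋ ≤ suc m C ⌈ m /2⌉
central-C-suc m with ⌈n/2⌉≡⌊n/2⌋⊎1+⌊n/2⌋ m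
... | inj₁ eq rewrite eq = C≤sucC ⌊ m /2⌋
  where
  C≤sucC : ∀ k → m C k ≤ suc m C k
  C≤sucC zero = ≤-refl
  C≤sucC (suc k) = subst (m C suc k ≤_) (nCk+nC[k+1]≡[n+1]C[k+1] m k) (m≤n+m _ _)
... | inj₂ eq rewrite eq = subst (m C ⌊ m /2⌋ ≤_) (nCk+nC[k+1]≡[n+1]C[k+1] m ⌊ m /2⌋) (m≤m+n _ _)

central-C-mono : ∀ {m n} → m ≤ n → m C ⌊ m /2⌋ ≤ n C ⌊ n /2⌋
central-C-mono {m} {n} m≤n with m≤n⇒m<n∨m≡n m≤n
... | inj₂ refl = ≤-refl
... | inj₁ (s≤s {n = n′} m≤n′) = ≤-trans (central-C-mono m≤n′) (central-C-suc n′)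

sperner-bound : ∀ {n q} m (M : Subset n) (sel : Subset q) (T : Fin q → Subset n) → ∣ M ∣ ≡ m →
  ∀ b → (if sel b then weight m ⌊ m /2⌋ else 0) ≤ (if sel b then weight m ∣ M ∩ T b ∣ else 0)
sperner-bound m M sel T ∣M∣ b with sel b
... | false = z≤n
... | true = weight-minimum m _ (subst (∣ M ∩ T b ∣ ≤_) ∣M∣ (∣∩∣≤ M (T b)))

sperner : ∀ {n q} m (M : Subset n) (sel : Subset q) (T : Fin q → Subset n) → ∣ M ∣ ≡ m →
  IsAntichainOn M sel T → ∣ sel ∣ ≤ m C ⌊ m /2⌋
sperner {q = q} m M sel T ∣M∣ anti =
  *-cancelʳ-≤ ∣ sel ∣ (m C ⌊ m /2⌋) (weight m ⌊ m /2⌋) {{⌊ m /2⌋ !* (m ∸ ⌊ m /2⌋) !≢0}} (begin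
  ∣ sel ∣ * weight m ⌊ m /2⌋                         ≡⟨ *-comm ∣ sel ∣ _ ⟩
  weight m ⌊ m /2⌋ * ∣ sel ∣                         ≡⟨ sym (sum-if-const sel (weight m ⌊ m /2⌋)) ⟩
  ∑[ b < q ] (if sel b then weight m ⌊ m /2⌋ else 0)  ≤⟨ sum-mono-≤ (sperner-bound m M sel T ∣M∣) ⟩
  lubellSum m M sel T                                ≤⟨ lubellSum≤ m M sel T ∣M∣ anti ⟩
  m !                                                ≡⟨ sym (C*weight≡! m ⌊ m /2⌋ (⌊n/2⌋≤n m)) ⟩
  (m C ⌊ m /2⌋) * weight m ⌊ m /2⌋                   ∎)
  where open ≤-Reasoning

sperner-equality : ∀ {n q} m (M : Subset n) (sel : Subset q) (T : Fin q → Subset n) → ∣ M ∣ ≡ m →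
  IsAntichainOn M sel T → ∣ sel ∣ ≡ m C ⌊ m /2⌋ →
  lubellSum m M sel T ≡ m ! × (∀ b → sel b ≡ true → ∣ M ∩ T b ∣ ≡ ⌊ m /2⌋ ⊎ ∣ M ∩ T b ∣ ≡ ⌈ m /2⌉)
sperner-equality {q = q} m M sel T ∣M∣ anti ∣sel∣ = lubellSum≡m! , central
  where
  lower≡m! : ∑[ b < q ] (if sel b then weight m ⌊ m /2⌋ else 0) ≡ m !
  lower≡m! = trans (sum-if-const sel (weight m ⌊ m /2⌋)) (trans (cong (weight m ⌊ m /2⌋ *_) ∣sel∣)
    (trans (*-comm (weight m ⌊ m /2⌋) _) (C*weight≡! m ⌊ m /2⌋ (⌊n/2⌋≤n m))))
  lubellSum≡m! : lubellSum m M sel T ≡ m !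
  lubellSum≡m! = ≤-antisym (lubellSum≤ m M sel T ∣M∣ anti)
    (subst (_≤ lubellSum m M sel T) lower≡m! (sum-mono-≤ (sperner-bound m M sel T ∣M∣)))
  central : ∀ b → sel b ≡ true → ∣ M ∩ T b ∣ ≡ ⌊ m /2⌋ ⊎ ∣ M ∩ T b ∣ ≡ ⌈ m /2⌉
  central b sb = weight≡minimum⇒central m _ (subst (∣ M ∩ T b ∣ ≤_) ∣M∣ (∣∩∣≤ M (T b)))
    (sym (subst (λ s → (if s then weight m ⌊ m /2⌋ else 0) ≡ (if s then weight m ∣ M ∩ T b ∣ else 0)) sb
      (≤-pointwise∧sum-≥⇒≡ _ _ (sperner-bound m M sel T ∣M∣) (≤-reflexive (trans lubellSum≡m! (sym lower≡m!))) b)))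

-- Enumerating the k-subsets of Fin n

pascal : ℕ → ℕ → ℕ
pascal zero zero = 1
pascal zero (suc k) = 0
pascal (suc n) zero = pascal n zero
pascal (suc n) (suc k) = pascal n k + pascal n (suc k)

pascal≡C : ∀ n k → pascal n k ≡ n C k
pascal≡C zero zero = refl
pascal≡C zero (suc k) = refl
pascal≡C (suc n) zero = pascal≡C n zero
pascal≡C (suc n) (suc k) = trans (cong₂ _+_ (pascal≡C n k) (pascal≡C n (suc k))) (nCk+nC[k+1]≡[n+1]C[k+1] n k)

unrank : ∀ n k → Fin (pascal n k) → Subset n
unrank zero zero _ = ⊥ₛ
unrank (suc n) zero i = false ◂ unrank n zero i
unrank (suc n) (suc k) i with splitAt (pascal n k) i
... | inj₁ j = true ◂ unrank n k j
... | inj₂ j = false ◂ unrank n (suc k) j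

rank : ∀ n k (A : Subset n) → ∣ A ∣ ≡ k → Fin (pascal n k)
rank zero zero A _ = zero
rank (suc n) k A ∣A∣ with A zero
rank (suc n) zero A ∣A∣ | false = rank n zero (tail A) ∣A∣
rank (suc n) (suc k) A ∣A∣ | false = pascal n k ↑ʳ rank n (suc k) (tail A) ∣A∣
rank (suc n) (suc k) A ∣A∣ | true = rank n k (tail A) (suc-injective ∣A∣) ↑ˡ pascal n (suc k)

∣unrank∣ : ∀ n k i → ∣ unrank n k i ∣ ≡ k
∣unrank∣ zero zero i = refl
∣unrank∣ (suc n) zero i = ∣unrank∣ n zero i
∣unrank∣ (suc n) (suc k) i with splitAt (pascal n k) i
... | inj₁ j = cong suc (∣unrank∣ n k j)
... | inj₂ j = ∣unrank∣ n (suc k) j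

unrank-rank : ∀ n k (A : Subset n) (∣A∣ : ∣ A ∣ ≡ k) → unrank n k (rank n k A ∣A∣) ≗ A
unrank-rank zero zero A ∣A∣ ()
unrank-rank (suc n) k A ∣A∣ a with A zero in A₀
unrank-rank (suc n) zero A ∣A∣ zero | false = sym A₀
unrank-rank (suc n) zero A ∣A∣ (suc a) | false = unrank-rank n zero (tail A) ∣A∣ a
unrank-rank (suc n) (suc k) A ∣A∣ a | false
  rewrite splitAt-↑ʳ (pascal n k) (pascal n (suc k)) (rank n (suc k) (tail A) ∣A∣) with a
... | zero = sym A₀
... | suc a′ = unrank-rank n (suc k) (tail A) ∣A∣ a′
unrank-rank (suc n) (suc k) A ∣A∣ a | true
  rewrite splitAt-↑ˡ (pascal n k) (rank n k (tail A) (suc-injective ∣A∣)) (pascal n (suc k)) with a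
... | zero = sym A₀
... | suc a′ = unrank-rank n k (tail A) (suc-injective ∣A∣) a′

rank-cong : ∀ n k (A B : Subset n) (∣A∣ : ∣ A ∣ ≡ k) (∣B∣ : ∣ B ∣ ≡ k) → A ≗ B → rank n k A ∣A∣ ≡ rank n k B ∣B∣
rank-cong zero zero A B _ _ _ = refl
rank-cong (suc n) k A B ∣A∣ ∣B∣ A≗B with A zero | B zero | A≗B zero
rank-cong (suc n) zero A B ∣A∣ ∣B∣ A≗B | false | false | refl =
  rank-cong n zero (tail A) (tail B) ∣A∣ ∣B∣ (λ a → A≗B (suc a))
rank-cong (suc n) (suc k) A B ∣A∣ ∣B∣ A≗B | false | false | refl =
  cong (pascal n k ↑ʳ_) (rank-cong n (suc k) (tail A) (tail B) ∣A∣ ∣B∣ (λ a → A≗B (suc a)))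
rank-cong (suc n) (suc k) A B ∣A∣ ∣B∣ A≗B | true | true | refl =
  cong (_↑ˡ pascal n (suc k)) (rank-cong n k (tail A) (tail B) (suc-injective ∣A∣) (suc-injective ∣B∣) (λ a → A≗B (suc a)))

rank-unrank : ∀ n k i (∣A∣ : ∣ unrank n k i ∣ ≡ k) → rank n k (unrank n k i) ∣A∣ ≡ i
rank-unrank zero zero zero _ = refl
rank-unrank (suc n) zero i ∣A∣ = rank-unrank n zero i ∣A∣
rank-unrank (suc n) (suc k) i ∣A∣ with splitAt (pascal n k) i in split
... | inj₁ j = trans (cong (_↑ˡ pascal n (suc k)) (rank-unrank n k j (suc-injective ∣A∣))) (splitAt⁻¹-↑ˡ split)
... | inj₂ j = trans (cong (pascal n k ↑ʳ_) (rank-unrank n (suc k) j ∣A∣)) (splitAt⁻¹-↑ʳ split)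

unrank-injective : ∀ n k i j → unrank n k i ≗ unrank n k j → i ≡ j
unrank-injective n k i j eq = begin
  i                                             ≡⟨ sym (rank-unrank n k i (∣unrank∣ n k i)) ⟩
  rank n k (unrank n k i) (∣unrank∣ n k i)      ≡⟨ rank-cong n k _ _ (∣unrank∣ n k i) (∣unrank∣ n k j) eq ⟩
  rank n k (unrank n k j) (∣unrank∣ n k j)      ≡⟨ rank-unrank n k j (∣unrank∣ n k j) ⟩
  j                                             ∎
  where open ≡-Reasoning

kSubset : ∀ n k → Fin (n C k) → Subset n
kSubset n k b = unrank n k (subst Fin (sym (pascal≡C n k)) b)

∣kSubset∣ : ∀ n k b → ∣ kSubset n k b ∣ ≡ k
∣kSubset∣ n k b = ∣unrank∣ n k _

kSubset-injective : ∀ n k b c → kSubset n k b ≗ kSubset n k c → b ≡ c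
kSubset-injective n k b c eq = subst-injective (sym (pascal≡C n k)) (unrank-injective n k _ _ eq)

kSubset-surjective : ∀ n k (A : Subset n) → ∣ A ∣ ≡ k → ∃ λ b → kSubset n k b ≗ A
kSubset-surjective n k A ∣A∣ = subst Fin (pascal≡C n k) (rank n k A ∣A∣) , λ a →
  trans (cong (λ i → unrank n k i a) (subst-sym-subst (pascal≡C n k))) (unrank-rank n k A ∣A∣ a)

-- Orientations of diameter two

same-or-other : ∀ i j → j ≡ i ⊎ j ≡ other i
same-or-other zero zero = inj₁ refl
same-or-other zero (suc zero) = inj₂ refl
same-or-other (suc zero) zero = inj₂ refl
same-or-other (suc zero) (suc zero) = inj₁ refl

other-involutive : ∀ i → other (other i) ≡ i
other-involutive zero = refl
other-involutive (suc zero) = refl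

within₂-cases : ∀ {p q} {D : Digraph p q} {x y} → Within D 2 x y →
  x ≡ y ⊎ Arc D x y ⊎ ∃ λ z → Arc D x z × Arc D z y
within₂-cases here = inj₁ refl
within₂-cases (step xy here) = inj₂ (inj₁ xy)
within₂-cases (step xz (step zy here)) = inj₂ (inj₂ (_ , xz , zy))

outV₃V₂ : ∀ {p q} → Digraph p q → Fin q → Subset p
outV₃V₂ D b a = D (v3 b) (v2 a)

module Diameter₂ {p q : ℕ} (D : Digraph p q) (O : IsOrientation D) (AW : AllWithin D 2) where
  open IsOrientation O

  α : Fin 2 → Fin p → Bool
  α j a = D (v1 j) (v2 a)

  β : Fin 2 → Fin q → Bool
  β j b = D (v3 b) (v1 j)

  T : Fin q → Subset p
  T = outV₃V₂ D

  reverse-false : ∀ x y → Adj x y → Arc D x y → D y x ≡ false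
  reverse-false x y xy xy-arc = ≢true (oneDir x y xy xy-arc)

  no-arc-inside : ∀ {x y} → part x ≡ part y → ¬ Arc D x y
  no-arc-inside {x} {y} same = noArc x y (λ adj → adj same)

  route₂₃ : ∀ b a → T b a ≡ true → ∃ λ j → α j a ≡ false × β j b ≡ false
  route₂₃ b a Tba with within₂-cases (AW (v2 a) (v3 b))
  ... | inj₂ (inj₁ arc) = ⊥-elim (true≢false Tba (reverse-false (v2 a) (v3 b) (λ ()) arc))
  ... | inj₂ (inj₂ (v1 j , r , s)) = j , reverse-false (v2 a) (v1 j) (λ ()) r , reverse-false (v1 j) (v3 b) (λ ()) s
  ... | inj₂ (inj₂ (v2 _ , r , _)) = ⊥-elim (no-arc-inside refl r)
  ... | inj₂ (inj₂ (v3 _ , _ , s)) = ⊥-elim (no-arc-inside refl s)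

  route₃₂ : ∀ b a → T b a ≡ false → ∃ λ j → α j a ≡ true × β j b ≡ true
  route₃₂ b a Tba with within₂-cases (AW (v3 b) (v2 a))
  ... | inj₂ (inj₁ arc) = ⊥-elim (true≢false arc Tba)
  ... | inj₂ (inj₂ (v1 j , r , s)) = j , s , r
  ... | inj₂ (inj₂ (v2 _ , _ , s)) = ⊥-elim (no-arc-inside refl s)
  ... | inj₂ (inj₂ (v3 _ , r , _)) = ⊥-elim (no-arc-inside refl r)

  route₃₃ : ∀ b c → b ≢ c →
    (∃ λ j → β j b ≡ true × β j c ≡ false) ⊎ (∃ λ a → T b a ≡ true × T c a ≡ false)
  route₃₃ b c b≢c with within₂-cases (AW (v3 b) (v3 c))
  ... | inj₁ refl = ⊥-elim (b≢c refl)
  ... | inj₂ (inj₁ arc) = ⊥-elim (no-arc-inside refl arc)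
  ... | inj₂ (inj₂ (v1 j , r , s)) = inj₁ (j , r , reverse-false (v1 j) (v3 c) (λ ()) s)
  ... | inj₂ (inj₂ (v2 a , r , s)) = inj₂ (a , r , reverse-false (v2 a) (v3 c) (λ ()) s)
  ... | inj₂ (inj₂ (v3 _ , r , _)) = ⊥-elim (no-arc-inside refl r)

  route₁₃ : ∀ j b → β j b ≡ true → ∃ λ a → α j a ≡ true × T b a ≡ false
  route₁₃ j b βjb with within₂-cases (AW (v1 j) (v3 b))
  ... | inj₂ (inj₁ arc) = ⊥-elim (true≢false βjb (reverse-false (v1 j) (v3 b) (λ ()) arc))
  ... | inj₂ (inj₂ (v1 _ , r , _)) = ⊥-elim (no-arc-inside refl r)
  ... | inj₂ (inj₂ (v2 a , r , s)) = a , r , reverse-false (v2 a) (v3 b) (λ ()) s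
  ... | inj₂ (inj₂ (v3 _ , _ , s)) = ⊥-elim (no-arc-inside refl s)

  route₃₁ : ∀ j b → β j b ≡ false → ∃ λ a → α j a ≡ false × T b a ≡ true
  route₃₁ j b βjb with within₂-cases (AW (v3 b) (v1 j))
  ... | inj₂ (inj₁ arc) = ⊥-elim (true≢false arc βjb)
  ... | inj₂ (inj₂ (v1 _ , _ , s)) = ⊥-elim (no-arc-inside refl s)
  ... | inj₂ (inj₂ (v2 a , r , s)) = a , reverse-false (v2 a) (v1 j) (λ ()) s , r
  ... | inj₂ (inj₂ (v3 _ , r , _)) = ⊥-elim (no-arc-inside refl r)

  onlyα : Fin 2 → Subset p
  onlyα i a = α i a ∧ not (α (other i) a)

  onlyβ : Fin 2 → Subset q
  onlyβ i b = β i b ∧ not (β (other i) b)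

  bothβ : Subset q
  bothβ b = β zero b ∧ β (suc zero) b

  neitherβ : Subset q
  neitherβ b = not (β zero b) ∧ not (β (suc zero) b)

  bothβ⇒β : ∀ {b} → bothβ b ≡ true → ∀ j → β j b ≡ true
  bothβ⇒β h zero = ∧-conicalˡ _ _ h
  bothβ⇒β h (suc zero) = ∧-conicalʳ _ _ h

  neitherβ⇒¬β : ∀ {b} → neitherβ b ≡ true → ∀ j → β j b ≡ false
  neitherβ⇒¬β h zero = not≡true (∧-conicalˡ _ _ h)
  neitherβ⇒¬β h (suc zero) = not≡true (∧-conicalʳ _ _ h)

  onlyβ-other : ∀ i b → onlyβ (other i) b ≡ β (other i) b ∧ not (β i b)
  onlyβ-other i b = cong (λ j → β (other i) b ∧ not (β j b)) (other-involutive i)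

  onlyβ⇒T≡notα : ∀ i b a → onlyβ i b ≡ true → onlyα i a ≡ false → T b a ≡ not (α i a)
  onlyβ⇒T≡notα i b a b∈ a∉ with T b a in Tba
  ... | true with route₂₃ b a Tba
  ...   | j , αja , βjb with same-or-other i j
  ...     | inj₁ refl = ⊥-elim (true≢false (∧-conicalˡ _ _ b∈) βjb)
  ...     | inj₂ refl rewrite αja = sym (cong not (trans (sym (∧-identityʳ (α i a))) a∉))
  onlyβ⇒T≡notα i b a b∈ a∉ | false with route₃₂ b a Tba
  ...   | j , αja , βjb with same-or-other i j
  ...     | inj₁ refl rewrite αja = refl
  ...     | inj₂ refl = ⊥-elim (true≢false βjb (not≡true (∧-conicalʳ _ _ b∈)))

  onlyβ-antichain : ∀ i → IsAntichainOn (onlyα i) (onlyβ i) T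
  onlyβ-antichain i b c b∈ c∈ b≢c with route₃₃ b c b≢c
  ... | inj₁ (j , βjb , βjc) with same-or-other i j
  ...   | inj₁ refl = ⊥-elim (true≢false (∧-conicalˡ _ _ c∈) βjc)
  ...   | inj₂ refl = ⊥-elim (true≢false βjb (not≡true (∧-conicalʳ _ _ b∈)))
  onlyβ-antichain i b c b∈ c∈ b≢c | inj₂ (a , Tba , Tca) with onlyα i a in a∈
  ... | true = a , a∈ , Tba , Tca
  ... | false = ⊥-elim (true≢false (trans (onlyβ⇒T≡notα i c a c∈ a∈)
                  (trans (sym (onlyβ⇒T≡notα i b a b∈ a∈)) Tba)) Tca)

  ∣onlyβ∣≤ : ∀ i → ∣ onlyβ i ∣ ≤ ∣ onlyα i ∣ C ⌊ ∣ onlyα i ∣ /2⌋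
  ∣onlyβ∣≤ i = sperner ∣ onlyα i ∣ (onlyα i) (onlyβ i) T refl (onlyβ-antichain i)

  ∣bothβ∣≤1 : ∣ bothβ ∣ ≤ 1
  ∣bothβ∣≤1 = ∣∣≤1 bothβ unique
    where
    unique : ∀ b c → bothβ b ≡ true → bothβ c ≡ true → b ≡ c
    unique b c b∈ c∈ with b ≟ᶠ c
    ... | yes b≡c = b≡c
    ... | no b≢c with route₃₃ b c b≢c
    ...   | inj₁ (j , _ , βjc) = ⊥-elim (true≢false (bothβ⇒β c∈ j) βjc)
    ...   | inj₂ (a , Tba , _) = let (j , _ , βjb) = route₂₃ b a Tba in ⊥-elim (true≢false (bothβ⇒β b∈ j) βjb)

  ∣neitherβ∣≤1 : ∣ neitherβ ∣ ≤ 1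
  ∣neitherβ∣≤1 = ∣∣≤1 neitherβ unique
    where
    unique : ∀ b c → neitherβ b ≡ true → neitherβ c ≡ true → b ≡ c
    unique b c b∈ c∈ with b ≟ᶠ c
    ... | yes b≡c = b≡c
    ... | no b≢c with route₃₃ b c b≢c
    ...   | inj₁ (j , βjb , _) = ⊥-elim (true≢false βjb (neitherβ⇒¬β b∈ j))
    ...   | inj₂ (a , _ , Tca) = let (j , _ , βjc) = route₃₂ c a Tca in ⊥-elim (true≢false βjc (neitherβ⇒¬β c∈ j))

  onlyβ-excludes-onlyα-other : ∀ i b a → onlyβ i b ≡ true → onlyα (other i) a ≡ true → ⊥
  onlyβ-excludes-onlyα-other i b a b∈ a∈ with T b a in Tba
  ... | true with route₂₃ b a Tba
  ...   | j , αja , βjb with same-or-other i j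
  ...     | inj₁ refl = true≢false (∧-conicalˡ _ _ b∈) βjb
  ...     | inj₂ refl = true≢false (∧-conicalˡ _ _ a∈) αja
  onlyβ-excludes-onlyα-other i b a b∈ a∈ | false with route₃₂ b a Tba
  ...   | j , αja , βjb with same-or-other i j
  ...     | inj₁ refl = true≢false αja (not≡true (subst (λ k → not (α k a) ≡ true) (other-involutive i) (∧-conicalʳ _ _ a∈)))
  ...     | inj₂ refl = true≢false βjb (not≡true (∧-conicalʳ _ _ b∈))

  bothβ-excludes-¬α : ∀ i b a → bothβ b ≡ true → α i a ≡ false → α (other i) a ≡ false → ⊥
  bothβ-excludes-¬α i b a b∈ αia αi′a with T b a in Tba
  ... | true = let (j , _ , βjb) = route₂₃ b a Tba in true≢false (bothβ⇒β b∈ j) βjb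
  ... | false with route₃₂ b a Tba
  ...   | j , αja , _ with same-or-other i j
  ...     | inj₁ refl = true≢false αja αia
  ...     | inj₂ refl = true≢false αja αi′a

  neitherβ-excludes-α : ∀ i b a → neitherβ b ≡ true → α i a ≡ true → α (other i) a ≡ true → ⊥
  neitherβ-excludes-α i b a b∈ αia αi′a with T b a in Tba
  ... | false = let (j , _ , βjb) = route₃₂ b a Tba in true≢false βjb (neitherβ⇒¬β b∈ j)
  ... | true with route₂₃ b a Tba
  ...   | j , αja , _ with same-or-other i j
  ...     | inj₁ refl = true≢false αia αja
  ...     | inj₂ refl = true≢false αi′a αja

  q≡∣onlyβ₀∣+∣onlyβ₁∣+rest : q ≡ ∣ onlyβ zero ∣ + ∣ onlyβ (suc zero) ∣ + (∣ bothβ ∣ + ∣ neitherβ ∣)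
  q≡∣onlyβ₀∣+∣onlyβ₁∣+rest = begin
    q                                                              ≡⟨ sym (∣⊤ₛ∣ q) ⟩
    ∣ ⊤ₛ {q} ∣                                                     ≡⟨ sum-cong-≗ {q} classify ⟩
    ∑[ b < q ] (𝟙 (onlyβ zero b) + 𝟙 (onlyβ (suc zero) b) + (𝟙 (bothβ b) + 𝟙 (neitherβ b)))
      ≡⟨ ∑-distrib-+ (λ b → 𝟙 (onlyβ zero b) + 𝟙 (onlyβ (suc zero) b)) (λ b → 𝟙 (bothβ b) + 𝟙 (neitherβ b)) ⟩
    ∑[ b < q ] (𝟙 (onlyβ zero b) + 𝟙 (onlyβ (suc zero) b)) + ∑[ b < q ] (𝟙 (bothβ b) + 𝟙 (neitherβ b))
      ≡⟨ cong₂ _+_ (∑-distrib-+ (λ b → 𝟙 (onlyβ zero b)) (λ b → 𝟙 (onlyβ (suc zero) b)))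
                   (∑-distrib-+ (λ b → 𝟙 (bothβ b)) (λ b → 𝟙 (neitherβ b))) ⟩
    ∣ onlyβ zero ∣ + ∣ onlyβ (suc zero) ∣ + (∣ bothβ ∣ + ∣ neitherβ ∣) ∎
    where
    open ≡-Reasoning
    𝟙 : Bool → ℕ
    𝟙 s = if s then 1 else 0
    classify : ∀ b → 1 ≡ 𝟙 (onlyβ zero b) + 𝟙 (onlyβ (suc zero) b) + (𝟙 (bothβ b) + 𝟙 (neitherβ b))
    classify b with β zero b | β (suc zero) b
    ... | true | true = refl
    ... | true | false = refl
    ... | false | true = refl
    ... | false | false = refl

  q≡∣onlyβ∣+∣onlyβ-other∣+rest : ∀ i → q ≡ ∣ onlyβ i ∣ + ∣ onlyβ (other i) ∣ + (∣ bothβ ∣ + ∣ neitherβ ∣)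
  q≡∣onlyβ∣+∣onlyβ-other∣+rest zero = q≡∣onlyβ₀∣+∣onlyβ₁∣+rest
  q≡∣onlyβ∣+∣onlyβ-other∣+rest (suc zero) = trans q≡∣onlyβ₀∣+∣onlyβ₁∣+rest
    (cong (_+ (∣ bothβ ∣ + ∣ neitherβ ∣)) (+-comm ∣ onlyβ zero ∣ ∣ onlyβ (suc zero) ∣))

  pattern-intro : ∀ i → (∀ a → onlyα i a ≡ true) → (∀ b → onlyβ i b ≡ true) → Pattern D i
  pattern-intro i αonly βonly =
    (λ a → ∧-conicalˡ _ _ (αonly a)) ,
    (λ a → someDir (v1 (other i)) (v2 a) (λ ()) (λ arc → true≢false arc (not≡true (∧-conicalʳ _ _ (αonly a))))) ,
    (λ b → someDir (v3 b) (v1 (other i)) (λ ()) (λ arc → true≢false arc (not≡true (∧-conicalʳ _ _ (βonly b))))) ,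
    (λ b → ∧-conicalˡ _ _ (βonly b))

  onlyα-full⇒pattern : ∀ i → (∀ a → onlyα i a ≡ true) → ∣ onlyβ (other i) ∣ ≡ 0 → Pattern D i
  onlyα-full⇒pattern i αonly ∣onlyβ′∣ = pattern-intro i αonly βonly
    where
    βonly : ∀ b → onlyβ i b ≡ true
    βonly b with β i b in βib | β (other i) b in βi′b
    ... | true | false = refl
    ... | true | true = let (a , αi′a , _) = route₁₃ (other i) b βi′b in
                        ⊥-elim (true≢false αi′a (not≡true (∧-conicalʳ _ _ (αonly a))))
    ... | false | false = let (a , αia , _) = route₃₁ i b βib in
                          ⊥-elim (true≢false (∧-conicalˡ _ _ (αonly a)) αia)
    ... | false | true = ⊥-elim (true≢false (trans (onlyβ-other i b) (cong₂ (λ x y → x ∧ not y) βi′b βib))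
                                           (∣∣≡0⇒≡⊥ₛ (onlyβ (other i)) ∣onlyβ′∣ b))

  ∣bothβ∣+∣neitherβ∣≤1 : ∀ i a → α i a ≡ α (other i) a → ∣ bothβ ∣ + ∣ neitherβ ∣ ≤ 1
  ∣bothβ∣+∣neitherβ∣≤1 i a αia≡αi′a with α i a in αia | α (other i) a in αi′a
  ... | true | true = subst (λ s → ∣ bothβ ∣ + s ≤ 1) (sym ∣neitherβ∣≡0) (subst (_≤ 1) (sym (+-identityʳ _)) ∣bothβ∣≤1)
    where
    ∣neitherβ∣≡0 = ≡⊥ₛ⇒∣∣≡0 neitherβ (λ b → ≢true (λ b∈ → neitherβ-excludes-α i b a b∈ αia αi′a))
  ... | false | false = subst (λ s → s + ∣ neitherβ ∣ ≤ 1) (sym ∣bothβ∣≡0) ∣neitherβ∣≤1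
    where
    ∣bothβ∣≡0 = ≡⊥ₛ⇒∣∣≡0 bothβ (λ b → ≢true (λ b∈ → bothβ-excludes-¬α i b a b∈ αia αi′a))

  module _ (N : ℕ) (3≤N : 3 ≤ N) (bound : ∀ m → m < p → m C ⌊ m /2⌋ ≤ N) where

    one-sided : ∀ i → 0 < ∣ onlyβ i ∣ → ∣ onlyβ (other i) ∣ ≡ 0 → Pattern D i ⊎ q ≤ N + 1
    one-sided i pos ∣onlyβ′∣ with ∣∣-pos⇒∃ (onlyβ i) pos | any? (λ a → onlyα i a ≟ᵇ false)
    ... | _ | no none = inj₁ (onlyα-full⇒pattern i (λ a → ≢false (λ a∉ → none (a , a∉))) ∣onlyβ′∣)
    ... | b₀ , b₀∈ | yes (a₀ , a₀∉) = inj₂ (begin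
      q                                                              ≡⟨ q≡∣onlyβ∣+∣onlyβ-other∣+rest i ⟩
      ∣ onlyβ i ∣ + ∣ onlyβ (other i) ∣ + (∣ bothβ ∣ + ∣ neitherβ ∣)
        ≡⟨ cong (λ s → s + (∣ bothβ ∣ + ∣ neitherβ ∣)) (trans (cong (∣ onlyβ i ∣ +_) ∣onlyβ′∣) (+-identityʳ _)) ⟩
      ∣ onlyβ i ∣ + (∣ bothβ ∣ + ∣ neitherβ ∣)                        ≤⟨ +-mono-≤ ∣onlyβ∣≤N (∣bothβ∣+∣neitherβ∣≤1 i a₀ αi≡αi′) ⟩
      N + 1                                                          ∎)
      where
      open ≤-Reasoning
      ∣onlyβ∣≤N : ∣ onlyβ i ∣ ≤ N
      ∣onlyβ∣≤N = ≤-trans (∣onlyβ∣≤ i) (bound _ (subst (∣ onlyα i ∣ <_) (∣⊤ₛ∣ p) (∣∩∣<∣∣ ⊤ₛ (onlyα i) a₀ refl a₀∉)))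
      αi≡αi′ : α i a₀ ≡ α (other i) a₀
      αi≡αi′ with α i a₀ in αia | α (other i) a₀ in αi′a
      ... | true | true = refl
      ... | false | false = refl
      ... | true | false = ⊥-elim (true≢false refl a₀∉)
      ... | false | true = ⊥-elim (onlyβ-excludes-onlyα-other i b₀ a₀ b₀∈
              (trans (cong (λ j → α (other i) a₀ ∧ not (α j a₀)) (other-involutive i)) (cong₂ (λ x y → x ∧ not y) αi′a αia)))

    pattern-or-small : Σ (Fin 2) (Pattern D) ⊎ q ≤ N + 1
    pattern-or-small with ∣ onlyβ zero ∣ in e₀ | ∣ onlyβ (suc zero) ∣ in e₁
    ... | suc _ | zero = Sum.map₁ (zero ,_) (one-sided zero (subst (0 <_) (sym e₀) (s≤s z≤n)) e₁)
    ... | zero | suc _ = Sum.map₁ (suc zero ,_) (one-sided (suc zero) (subst (0 <_) (sym e₁) (s≤s z≤n)) e₀)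
    ... | zero | zero = inj₂ (begin
      q                                                              ≡⟨ q≡∣onlyβ₀∣+∣onlyβ₁∣+rest ⟩
      ∣ onlyβ zero ∣ + ∣ onlyβ (suc zero) ∣ + (∣ bothβ ∣ + ∣ neitherβ ∣) ≡⟨ cong₂ (λ x y → x + y + (∣ bothβ ∣ + ∣ neitherβ ∣)) e₀ e₁ ⟩
      ∣ bothβ ∣ + ∣ neitherβ ∣                                        ≤⟨ +-mono-≤ ∣bothβ∣≤1 ∣neitherβ∣≤1 ⟩
      2                                                              ≤⟨ ≤-trans (s≤s (s≤s z≤n)) (≤-trans 3≤N (m≤m+n N 1)) ⟩
      N + 1                                                          ∎)
      where open ≤-Reasoning
    ... | suc _ | suc _ with ∣∣-pos⇒∃ (onlyβ zero) (subst (0 <_) (sym e₀) (s≤s z≤n))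
                           | ∣∣-pos⇒∃ (onlyβ (suc zero)) (subst (0 <_) (sym e₁) (s≤s z≤n))
    ...   | b , b∈ | c , c∈ = inj₂ (begin
      q                                                              ≡⟨ q≡∣onlyβ₀∣+∣onlyβ₁∣+rest ⟩
      ∣ onlyβ zero ∣ + ∣ onlyβ (suc zero) ∣ + (∣ bothβ ∣ + ∣ neitherβ ∣)
        ≤⟨ +-mono-≤ (+-mono-≤ (≤1 zero c∈) (≤1 (suc zero) b∈)) (+-mono-≤ ∣bothβ∣≤1 ∣neitherβ∣≤1) ⟩
      4                                                              ≤⟨ subst (4 ≤_) (+-comm 1 N) (s≤s 3≤N) ⟩
      N + 1                                                          ∎)
      where
      open ≤-Reasoning
      ≤1 : ∀ i {c} → onlyβ (other i) c ≡ true → ∣ onlyβ i ∣ ≤ 1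
      ≤1 i c∈ = subst (λ m → ∣ onlyβ i ∣ ≤ m C ⌊ m /2⌋) (≡⊥ₛ⇒∣∣≡0 (onlyα i) (λ a → ≢true (λ a∈ →
        onlyβ-excludes-onlyα-other (other i) _ a c∈ (subst (λ j → onlyα j a ≡ true) (sym (other-involutive i)) a∈))))
        (∣onlyβ∣≤ i)

  pattern⇒antichain : ∀ i → Pattern D i → IsAntichainOn ⊤ₛ ⊤ₛ T
  pattern⇒antichain i (_ , _ , 1′→3 , 3→1) b c _ _ b≢c with route₃₃ b c b≢c
  ... | inj₂ (a , Tba , Tca) = a , refl , Tba , Tca
  ... | inj₁ (j , βjb , βjc) with same-or-other i j
  ...   | inj₁ refl = ⊥-elim (true≢false (3→1 c) βjc)
  ...   | inj₂ refl = ⊥-elim (true≢false βjb (reverse-false (v1 (other i)) (v3 b) (λ ()) (1′→3 b)))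

  pattern-unique : Fin p → ∀ i j → Pattern D i → Pattern D j → j ≡ i
  pattern-unique a i j (_ , 2→1′ , _) (1→2 , _) with same-or-other i j
  ... | inj₁ j≡i = j≡i
  ... | inj₂ refl = ⊥-elim (oneDir (v1 (other i)) (v2 a) (λ ()) (1→2 a) (2→1′ a))

same : Fin 2 → Fin 2 → Bool
same zero zero = true
same zero (suc zero) = false
same (suc zero) zero = false
same (suc zero) (suc zero) = true

same-refl : ∀ i → same i i ≡ true
same-refl zero = refl
same-refl (suc zero) = refl

same-other : ∀ i → same (other i) i ≡ false
same-other zero = refl
same-other (suc zero) = refl

canonical : ∀ {p q} → Fin 2 → (Fin q → Subset p) → Digraph p q
canonical i T (v1 j) (v2 a) = same j i
canonical i T (v2 a) (v1 j) = not (same j i)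
canonical i T (v1 j) (v3 b) = not (same j i)
canonical i T (v3 b) (v1 j) = same j i
canonical i T (v2 a) (v3 b) = not (T b a)
canonical i T (v3 b) (v2 a) = T b a
canonical i T (v1 _) (v1 _) = false
canonical i T (v2 _) (v2 _) = false
canonical i T (v3 _) (v3 _) = false

orientation-intro : ∀ {p q} (D : Digraph p q) → (∀ x y → ¬ Adj x y → D x y ≡ false) →
  (∀ x y → Adj x y → D y x ≡ not (D x y)) → IsOrientation D
orientation-intro D none reverse = record
  { noArc = λ x y ¬xy arc → true≢false arc (none x y ¬xy)
  ; oneDir = λ x y xy arc arc′ → true≢false arc′ (trans (reverse x y xy) (cong not arc))
  ; someDir = λ x y xy ¬arc → trans (reverse x y xy) (cong not (≢true ¬arc))
  }

canonical-orientation : ∀ {p q} i (T : Fin q → Subset p) → IsOrientation (canonical i T)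
canonical-orientation {p} {q} i T = orientation-intro (canonical i T) none reverse
  where
  none : ∀ x y → ¬ Adj x y → canonical i T x y ≡ false
  none (v1 _) (v1 _) _ = refl
  none (v2 _) (v2 _) _ = refl
  none (v3 _) (v3 _) _ = refl
  none (v1 _) (v2 _) ¬xy = ⊥-elim (¬xy (λ ()))
  none (v1 _) (v3 _) ¬xy = ⊥-elim (¬xy (λ ()))
  none (v2 _) (v1 _) ¬xy = ⊥-elim (¬xy (λ ()))
  none (v2 _) (v3 _) ¬xy = ⊥-elim (¬xy (λ ()))
  none (v3 _) (v1 _) ¬xy = ⊥-elim (¬xy (λ ()))
  none (v3 _) (v2 _) ¬xy = ⊥-elim (¬xy (λ ()))
  reverse : ∀ x y → Adj x y → canonical i T y x ≡ not (canonical i T x y)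
  reverse (v1 j) (v2 a) _ = refl
  reverse (v2 a) (v1 j) _ = sym (not-involutive _)
  reverse (v1 j) (v3 b) _ = sym (not-involutive _)
  reverse (v3 b) (v1 j) _ = refl
  reverse (v2 a) (v3 b) _ = sym (not-involutive _)
  reverse (v3 b) (v2 a) _ = refl
  reverse (v1 _) (v1 _) xy = ⊥-elim (xy refl)
  reverse (v2 _) (v2 _) xy = ⊥-elim (xy refl)
  reverse (v3 _) (v3 _) xy = ⊥-elim (xy refl)

pattern⇒canonical : ∀ {p q} (D : Digraph p q) → IsOrientation D → ∀ i → Pattern D i →
  ∀ x y → D x y ≡ canonical i (outV₃V₂ D) x y
pattern⇒canonical D O i (1→2 , 2→1′ , 1′→3 , 3→1) = from-pattern
  where
  open IsOrientation O
  reverse : ∀ x y → Adj x y → D y x ≡ not (D x y)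
  reverse x y xy with D x y in arc
  ... | true = ≢true (oneDir x y xy arc)
  ... | false = someDir x y xy (λ arc′ → true≢false arc′ arc)
  none : ∀ x y → part x ≡ part y → D x y ≡ false
  none x y same-part = ≢true (noArc x y (λ xy → xy same-part))
  from-pattern : ∀ x y → D x y ≡ canonical i (outV₃V₂ D) x y
  from-pattern (v1 j) (v2 a) with same-or-other i j
  ... | inj₁ refl = trans (1→2 a) (sym (same-refl i))
  ... | inj₂ refl = trans (trans (reverse (v2 a) (v1 (other i)) (λ ())) (cong not (2→1′ a))) (sym (same-other i))
  from-pattern (v2 a) (v1 j) with same-or-other i j
  ... | inj₁ refl = trans (trans (reverse (v1 i) (v2 a) (λ ())) (cong not (1→2 a))) (cong not (sym (same-refl i)))
  ... | inj₂ refl = trans (2→1′ a) (cong not (sym (same-other i)))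
  from-pattern (v1 j) (v3 b) with same-or-other i j
  ... | inj₁ refl = trans (trans (reverse (v3 b) (v1 i) (λ ())) (cong not (3→1 b))) (cong not (sym (same-refl i)))
  ... | inj₂ refl = trans (1′→3 b) (cong not (sym (same-other i)))
  from-pattern (v3 b) (v1 j) with same-or-other i j
  ... | inj₁ refl = trans (3→1 b) (sym (same-refl i))
  ... | inj₂ refl = trans (trans (reverse (v1 (other i)) (v3 b) (λ ())) (cong not (1′→3 b))) (sym (same-other i))
  from-pattern (v2 a) (v3 b) = reverse (v3 b) (v2 a) (λ ())
  from-pattern (v3 b) (v2 a) = refl
  from-pattern (v1 j) (v1 j′) = none (v1 j) (v1 j′) refl
  from-pattern (v2 a) (v2 a′) = none (v2 a) (v2 a′) refl
  from-pattern (v3 b) (v3 b′) = none (v3 b) (v3 b′) refl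

relabel : Fin 2 → Fin 2 → Fin 2 → Fin 2
relabel i₁ i₂ j = if same i₁ i₂ then j else other j

same-relabel : ∀ i₁ i₂ j → same (relabel i₁ i₂ j) i₂ ≡ same j i₁
same-relabel zero zero zero = refl
same-relabel zero zero (suc zero) = refl
same-relabel zero (suc zero) zero = refl
same-relabel zero (suc zero) (suc zero) = refl
same-relabel (suc zero) zero zero = refl
same-relabel (suc zero) zero (suc zero) = refl
same-relabel (suc zero) (suc zero) zero = refl
same-relabel (suc zero) (suc zero) (suc zero) = refl

relabel-involutive : ∀ i₁ i₂ j → relabel i₁ i₂ (relabel i₁ i₂ j) ≡ j
relabel-involutive i₁ i₂ j with same i₁ i₂
... | true = refl
... | false = other-involutive j

canonical-iso : ∀ {p q} i₁ i₂ (T₁ T₂ : Fin q → Subset p) (π π⁻¹ : Fin q → Fin q) →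
  (∀ c → π (π⁻¹ c) ≡ c) → (∀ b → π⁻¹ (π b) ≡ b) → (∀ b → T₂ (π b) ≗ T₁ b) →
  Iso (canonical i₁ T₁) (canonical i₂ T₂)
canonical-iso {p} {q} i₁ i₂ T₁ T₂ π π⁻¹ ππ⁻¹ π⁻¹π T₂π = mk↔ₛ′ to from to-from from-to , preserves
  where
  to : V p q → V p q
  to (v1 j) = v1 (relabel i₁ i₂ j)
  to (v2 a) = v2 a
  to (v3 b) = v3 (π b)
  from : V p q → V p q
  from (v1 j) = v1 (relabel i₁ i₂ j)
  from (v2 a) = v2 a
  from (v3 c) = v3 (π⁻¹ c)
  to-from : ∀ y → to (from y) ≡ y
  to-from (v1 j) = cong v1 (relabel-involutive i₁ i₂ j)
  to-from (v2 a) = refl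
  to-from (v3 c) = cong v3 (ππ⁻¹ c)
  from-to : ∀ x → from (to x) ≡ x
  from-to (v1 j) = cong v1 (relabel-involutive i₁ i₂ j)
  from-to (v2 a) = refl
  from-to (v3 b) = cong v3 (π⁻¹π b)
  preserves : ∀ x y → canonical i₁ T₁ x y ≡ canonical i₂ T₂ (to x) (to y)
  preserves (v1 j) (v2 a) = sym (same-relabel i₁ i₂ j)
  preserves (v2 a) (v1 j) = cong not (sym (same-relabel i₁ i₂ j))
  preserves (v1 j) (v3 b) = cong not (sym (same-relabel i₁ i₂ j))
  preserves (v3 b) (v1 j) = sym (same-relabel i₁ i₂ j)
  preserves (v2 a) (v3 b) = cong not (sym (T₂π b a))
  preserves (v3 b) (v2 a) = sym (T₂π b a)
  preserves (v1 _) (v1 _) = refl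
  preserves (v2 _) (v2 _) = refl
  preserves (v3 _) (v3 _) = refl

-- Two families enumerating the same full layer differ by a permutation of the index set.
layers⇒canonical-iso : ∀ {p q} k i₁ i₂ (T₁ T₂ : Fin q → Subset p) →
  IsLayer ⊤ₛ ⊤ₛ T₁ k → IsLayer ⊤ₛ ⊤ₛ T₂ k →
  (∀ b c → T₁ b ≗ T₁ c → b ≡ c) → (∀ b c → T₂ b ≗ T₂ c → b ≡ c) →
  Iso (canonical i₁ T₁) (canonical i₂ T₂)
layers⇒canonical-iso k i₁ i₂ T₁ T₂ L₁ L₂ inj₁′ inj₂′ =
  canonical-iso i₁ i₂ T₁ T₂ π π⁻¹
    (λ c → inj₂′ _ _ (λ a → trans (T₂π (π⁻¹ c) a) (T₁π⁻¹ c a)))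
    (λ b → inj₁′ _ _ (λ a → trans (T₁π⁻¹ (π b) a) (T₂π b a)))
    T₂π
  where
  module L₁ = IsLayer L₁
  module L₂ = IsLayer L₂
  π = λ b → proj₁ (L₂.complete (T₁ b) (L₁.size b refl))
  T₂π : ∀ b → T₂ (π b) ≗ T₁ b
  T₂π b a = proj₂ (proj₂ (L₂.complete (T₁ b) (L₁.size b refl))) a refl
  π⁻¹ = λ c → proj₁ (L₁.complete (T₂ c) (L₂.size c refl))
  T₁π⁻¹ : ∀ c → T₁ (π⁻¹ c) ≗ T₂ c
  T₁π⁻¹ c a = proj₂ (proj₂ (L₁.complete (T₂ c) (L₂.size c refl))) a refl

-- An orientation of diameter two built from the h-subsets

within-mono : ∀ {p q} {D : Digraph p q} {k k′ x y} → k ≤ k′ → Within D k x y → Within D k′ x y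
within-mono _ here = here
within-mono (s≤s k≤k′) (step arc w) = step arc (within-mono k≤k′ w)

diameter≥2 : ∀ {p q} {D : Digraph p q} → IsOrientation D → ∀ e → AllWithin D e → 2 ≤ e
diameter≥2 {D = D} O e AW = from-path e (AW (v1 zero) (v1 (suc zero)))
  where
  from-path : ∀ e → Within D e (v1 zero) (v1 (suc zero)) → 2 ≤ e
  from-path (suc zero) (step arc here) = ⊥-elim (IsOrientation.noArc O (v1 zero) (v1 (suc zero)) (λ xy → xy refl) arc)
  from-path (suc (suc e)) _ = s≤s (s≤s z≤n)

other-element : ∀ {n} → 2 ≤ n → (a : Fin n) → ∃ λ a′ → a′ ≢ a
other-element {suc (suc n)} _ zero = suc zero , λ ()
other-element {suc (suc n)} _ (suc _) = zero , λ ()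
other-element {suc zero} (s≤s ()) _

module KSubsetOrientation (p h : ℕ) (1≤h : 1 ≤ h) (h<p : h < p) where

  E : Fin (p C h) → Subset p
  E = kSubset p h

  Dₕ : Digraph p (p C h)
  Dₕ = canonical zero E

  2≤p : 2 ≤ p
  2≤p = ≤-trans (s≤s 1≤h) h<p

  separating : ∀ a a′ → a ≢ a′ → ∃ λ b → E b a ≡ false × E b a′ ≡ true
  separating a a′ a≢a′ = b , trans (E≗A a) A-a , trans (E≗A a′) A-a′
    where
    R = (⊤ₛ ─ a) ─ a′
    a′∈⊤─a : (⊤ₛ ─ a) a′ ≡ true
    a′∈⊤─a = A─x≡A ⊤ₛ (≢-sym a≢a′)
    ∣R∣ : suc (suc ∣ R ∣) ≡ p
    ∣R∣ = trans (cong suc (∣─∣ (⊤ₛ ─ a) a′ a′∈⊤─a)) (trans (∣─∣ ⊤ₛ a refl) (∣⊤ₛ∣ p))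
    subset = ∃-subset-of-size R (pred h) (pred-mono-≤ (s≤s⁻¹ (subst (suc h ≤_) (sym ∣R∣) h<p)))
    B = proj₁ subset
    B⊆R = proj₂ (proj₂ subset)
    B-outside : ∀ x → R x ≡ false → B x ≡ false
    B-outside x Rx = ≢true (λ Bx → true≢false (B⊆R x Bx) Rx)
    Ba′ : B a′ ≡ false
    Ba′ = B-outside a′ (x∉A─x (⊤ₛ ─ a) a′)
    A = B ∪ ⁅ a′ ⁆
    ∣A∣ : ∣ A ∣ ≡ h
    ∣A∣ = trans (∣∪⁅x⁆∣ B a′ Ba′) (trans (cong suc (proj₁ (proj₂ subset))) (suc-pred h {{>-nonZero 1≤h}}))
    b = proj₁ (kSubset-surjective p h A ∣A∣)
    E≗A = proj₂ (kSubset-surjective p h A ∣A∣)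
    A-a : A a ≡ false
    A-a = cong₂ _∨_ (B-outside a (trans (A─x≡A (⊤ₛ ─ a) a≢a′) (x∉A─x ⊤ₛ a))) (y∉⁅x⁆ a≢a′)
    A-a′ : A a′ ≡ true
    A-a′ = trans (cong (B a′ ∨_) (x∈⁅x⁆ a′)) (∨-zeroʳ (B a′))

  covering : ∀ a → ∃ λ b → E b a ≡ true
  covering a = let (a′ , a′≢a) = other-element 2≤p a ; (b , _ , Eba) = separating a′ a a′≢a in b , Eba

  missing : ∀ a → ∃ λ b → E b a ≡ false
  missing a = let (a′ , a′≢a) = other-element 2≤p a ; (b , Eba , _) = separating a a′ (≢-sym a′≢a) in b , Eba

  nonempty : ∀ b → ∃ λ a → E b a ≡ true
  nonempty b = ∣∣-pos⇒∃ (E b) (subst (0 <_) (sym (∣kSubset∣ p h b)) 1≤h)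

  proper : ∀ b → ∃ λ a → E b a ≡ false
  proper b = let (a , _ , Eba) = ∣∩∣<⇒∃ ⊤ₛ (E b) ∣Eb∣<p in a , Eba
    where
    ∣Eb∣<p : ∣ ⊤ₛ ∩ E b ∣ < ∣ ⊤ₛ {p} ∣
    ∣Eb∣<p = subst₂ _<_ (sym (∣kSubset∣ p h b)) (sym (∣⊤ₛ∣ p)) h<p

  distinct : ∀ b c → b ≢ c → ∃ λ a → E b a ≡ true × E c a ≡ false
  distinct b c b≢c with ∣ E b ∩ E c ∣ <? ∣ E b ∣
  ... | yes lt = ∣∩∣<⇒∃ (E b) (E c) lt
  ... | no ≮ = ⊥-elim (b≢c (kSubset-injective p h b c Eb≗Ec))
    where
    ∣Eb∩Ec∣ : ∣ E b ∩ E c ∣ ≡ ∣ E b ∣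
    ∣Eb∩Ec∣ = ≤-antisym (∣∩∣≤ (E b) (E c)) (≮⇒≥ ≮)
    ∣Ec∩Eb∣ : ∣ E c ∩ E b ∣ ≡ ∣ E c ∣
    ∣Ec∩Eb∣ = trans (∣∣-cong (λ a → ∧-comm (E c a) (E b a)))
                (trans ∣Eb∩Ec∣ (trans (∣kSubset∣ p h b) (sym (∣kSubset∣ p h c))))
    Eb≗Ec : E b ≗ E c
    Eb≗Ec a with E b a in Eba | E c a in Eca
    ... | true | true = refl
    ... | false | false = refl
    ... | true | false = ⊥-elim (true≢false (∣∩∣≡⇒⊆ (E b) (E c) ∣Eb∩Ec∣ a Eba) Eca)
    ... | false | true = ⊥-elim (true≢false (∣∩∣≡⇒⊆ (E c) (E b) ∣Ec∩Eb∣ a Eca) Eba)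

  a₀ : Fin p
  a₀ = fromℕ< h<p

  path : ∀ {x z y} → Arc Dₕ x z → Arc Dₕ z y → Within Dₕ 2 x y
  path xz zy = step xz (step zy here)

  Dₕ-within₂ : AllWithin Dₕ 2
  Dₕ-within₂ (v1 zero) (v1 zero) = here
  Dₕ-within₂ (v1 zero) (v1 (suc zero)) = path {z = v2 a₀} refl refl
  Dₕ-within₂ (v1 (suc zero)) (v1 zero) = path {z = v3 (proj₁ (covering a₀))} refl refl
  Dₕ-within₂ (v1 (suc zero)) (v1 (suc zero)) = here
  Dₕ-within₂ (v1 zero) (v2 a) = step refl here
  Dₕ-within₂ (v1 (suc zero)) (v2 a) = let (b , Eba) = covering a in path {z = v3 b} refl Eba
  Dₕ-within₂ (v1 zero) (v3 b) = let (a , Eba) = proper b in path {z = v2 a} refl (cong not Eba)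
  Dₕ-within₂ (v1 (suc zero)) (v3 b) = step refl here
  Dₕ-within₂ (v2 a) (v1 zero) = let (b , Eba) = missing a in path {z = v3 b} (cong not Eba) refl
  Dₕ-within₂ (v2 a) (v1 (suc zero)) = step refl here
  Dₕ-within₂ (v2 a) (v2 a′) with a ≟ᶠ a′
  ... | yes refl = here
  ... | no a≢a′ = let (b , Eba , Eba′) = separating a a′ a≢a′ in path {z = v3 b} (cong not Eba) Eba′
  Dₕ-within₂ (v2 a) (v3 b) with E b a in Eba
  ... | false = step (cong not Eba) here
  ... | true = path {z = v1 (suc zero)} refl refl
  Dₕ-within₂ (v3 b) (v1 zero) = step refl here
  Dₕ-within₂ (v3 b) (v1 (suc zero)) = let (a , Eba) = nonempty b in path {z = v2 a} Eba refl
  Dₕ-within₂ (v3 b) (v2 a) with E b a in Eba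
  ... | true = step Eba here
  ... | false = path {z = v1 zero} refl refl
  Dₕ-within₂ (v3 b) (v3 c) with b ≟ᶠ c
  ... | yes refl = here
  ... | no b≢c = let (a , Eba , Eca) = distinct b c b≢c in path {z = v2 a} Eba (cong not Eca)

  Dₕ-diameter : HasDiam Dₕ 2
  Dₕ-diameter = Dₕ-within₂ , diameter≥2 (canonical-orientation zero E)

antichain⇒injective : ∀ {p q} (T : Fin q → Subset p) → IsAntichainOn ⊤ₛ ⊤ₛ T → ∀ b c → T b ≗ T c → b ≡ c
antichain⇒injective T anti b c Tb≗Tc with b ≟ᶠ c
... | yes b≡c = b≡c
... | no b≢c = let (a , _ , Tba , Tca) = anti b c refl refl b≢c in ⊥-elim (true≢false (trans (sym (Tb≗Tc a)) Tba) Tca)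

antichain⇒independent : ∀ {p q} (D : Digraph p q) → IsAntichainOn ⊤ₛ ⊤ₛ (outV₃V₂ D) →
  ∀ b c → b ≢ c → Independent (OutV2 D b) (OutV2 D c)
antichain⇒independent D anti b c b≢c = not-⊆ b c b≢c , not-⊆ c b (≢-sym b≢c)
  where
  not-⊆ : ∀ b c → b ≢ c → ¬ (OutV2 D b ⊆₂ OutV2 D c)
  not-⊆ b c b≢c b⊆c = let (a , _ , Tba , Tca) = anti b c refl refl b≢c in true≢false (b⊆c a Tba) Tca

pattern-exists : ∀ p q → 4 ≤ p → 1 + (p ∸ 1) C ⌊ p ∸ 1 /2⌋ < q →
  (D : Digraph p q) → IsOrientation D → AllWithin D 2 → Σ (Fin 2) (Pattern D)
pattern-exists p q 4≤p N+1<q D O AW =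
  Sum.[ (λ found → found) , (λ q≤N+1 → ⊥-elim (<-irrefl refl (≤-trans N+1<q (subst (q ≤_) (+-comm N 1) q≤N+1)))) ]′
    (Diameter₂.pattern-or-small D O AW N 3≤N bound)
  where
  N = (p ∸ 1) C ⌊ p ∸ 1 /2⌋
  3≤N : 3 ≤ N
  3≤N = central-C-mono {3} (∸-monoˡ-≤ 1 4≤p)
  bound : ∀ m → m < p → m C ⌊ m /2⌋ ≤ N
  bound m m<p = central-C-mono (∸-monoˡ-≤ 1 m<p)

diameter₂-structure : ∀ p q → 4 ≤ p → 1 + (p ∸ 1) C ⌊ p ∸ 1 /2⌋ < q → (D : Digraph p q) → IsOrientation D → AllWithin D 2 →
  Σ (Fin 2) (λ i → Pattern D i × (∀ j → Pattern D j → j ≡ i)) ×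
  (∀ b c → b ≢ c → Independent (OutV2 D b) (OutV2 D c))
diameter₂-structure p q 4≤p N+1<q D O AW =
  (i , patᵢ , λ j → Diameter₂.pattern-unique D O AW (fromℕ< (≤-trans (s≤s z≤n) 4≤p)) i j patᵢ) ,
  antichain⇒independent D (Diameter₂.pattern⇒antichain D O AW i patᵢ)
  where
  i = proj₁ (pattern-exists p q 4≤p N+1<q D O AW)
  patᵢ = proj₂ (pattern-exists p q 4≤p N+1<q D O AW)

pigeonhole₃ : ∀ {x y a b c : ℕ} → (a ≡ x ⊎ a ≡ y) → (b ≡ x ⊎ b ≡ y) → (c ≡ x ⊎ c ≡ y) →
  a ≡ b ⊎ a ≡ c ⊎ b ≡ c
pigeonhole₃ (inj₁ refl) (inj₁ refl) _ = inj₁ refl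
pigeonhole₃ (inj₂ refl) (inj₂ refl) _ = inj₁ refl
pigeonhole₃ (inj₁ refl) (inj₂ refl) (inj₁ refl) = inj₂ (inj₁ refl)
pigeonhole₃ (inj₁ refl) (inj₂ refl) (inj₂ refl) = inj₂ (inj₂ refl)
pigeonhole₃ (inj₂ refl) (inj₁ refl) (inj₁ refl) = inj₂ (inj₂ refl)
pigeonhole₃ (inj₂ refl) (inj₁ refl) (inj₂ refl) = inj₂ (inj₁ refl)

record LayerShape {p q : ℕ} (D : Digraph p q) (k : ℕ) : Set where
  field
    orientation : IsOrientation D
    i           : Fin 2
    shape       : Pattern D i
    layer       : IsLayer ⊤ₛ ⊤ₛ (outV₃V₂ D) k
    injective   : ∀ b c → outV₃V₂ D b ≗ outV₃V₂ D c → b ≡ c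

same-shape⇒iso : ∀ {p q} {D₁ D₂ : Digraph p q} {k} → LayerShape D₁ k → LayerShape D₂ k → Iso D₁ D₂
same-shape⇒iso {D₁ = D₁} {D₂} S₁ S₂ = f , λ x y → begin
  D₁ x y                                     ≡⟨ pattern⇒canonical D₁ S₁.orientation S₁.i S₁.shape x y ⟩
  canonical S₁.i (outV₃V₂ D₁) x y            ≡⟨ preserves x y ⟩
  canonical S₂.i (outV₃V₂ D₂) (to x) (to y)  ≡⟨ sym (pattern⇒canonical D₂ S₂.orientation S₂.i S₂.shape (to x) (to y)) ⟩
  D₂ (to x) (to y)                           ∎
  where
  open ≡-Reasoning
  module S₁ = LayerShape S₁
  module S₂ = LayerShape S₂
  iso = layers⇒canonical-iso _ S₁.i S₂.i (outV₃V₂ D₁) (outV₃V₂ D₂) S₁.layer S₂.layer S₁.injective S₂.injective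
  f = proj₁ iso
  preserves = proj₂ iso
  to = Inverse.to f

module CentralCase (p : ℕ) (4≤p : 4 ≤ p) (N+1<q : 1 + (p ∸ 1) C ⌊ p ∸ 1 /2⌋ < p C ⌊ p /2⌋) where

  h = ⌊ p /2⌋

  1≤h : 1 ≤ h
  1≤h = ⌊n/2⌋-mono {2} (≤-trans (s≤s (s≤s z≤n)) 4≤p)

  h<p : h < p
  h<p = ≤-trans (+-monoˡ-≤ h 1≤h) (⌊n/2⌋+⌊n/2⌋≤n p)

  open KSubsetOrientation p h 1≤h h<p using (Dₕ; Dₕ-diameter)

  optimal⇒within₂ : (D : Digraph p (p C h)) → Optimal D → AllWithin D 2
  optimal⇒within₂ D (O , d , (AW , _) , best) x y =
    within-mono (best Dₕ 2 (canonical-orientation zero _) Dₕ-diameter) (AW x y)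

  optimal⇒shape : (D : Digraph p (p C h)) → Optimal D → Σ ℕ λ k → (k ≡ h ⊎ k ≡ ⌈ p /2⌉) × LayerShape D k
  optimal⇒shape D opt =
    k , k-central , record { orientation = O ; i = i ; shape = patᵢ ; layer = layer ; injective = antichain⇒injective T anti }
    where
    O = proj₁ opt
    AW = optimal⇒within₂ D opt
    T = outV₃V₂ D
    i = proj₁ (pattern-exists p (p C h) 4≤p N+1<q D O AW)
    patᵢ = proj₂ (pattern-exists p (p C h) 4≤p N+1<q D O AW)
    anti = Diameter₂.pattern⇒antichain D O AW i patᵢ
    extremal = sperner-equality p ⊤ₛ ⊤ₛ T (∣⊤ₛ∣ p) anti (∣⊤ₛ∣ (p C h))
    k = proj₁ (lubellSum≡⇒layer p ⊤ₛ ⊤ₛ T (∣⊤ₛ∣ p) anti (proj₁ extremal))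
    layer = proj₂ (proj₂ (lubellSum≡⇒layer p ⊤ₛ ⊤ₛ T (∣⊤ₛ∣ p) anti (proj₁ extremal)))
    b₀ = fromℕ< (≤-trans (s≤s z≤n) N+1<q)
    k-central : k ≡ h ⊎ k ≡ ⌈ p /2⌉
    k-central = Sum.map (trans (sym (IsLayer.size layer b₀ refl))) (trans (sym (IsLayer.size layer b₀ refl)))
                  (proj₂ extremal b₀ refl)

  two-isomorphic : (D₁ D₂ D₃ : Digraph p (p C h)) → Optimal D₁ → Optimal D₂ → Optimal D₃ →
    Iso D₁ D₂ ⊎ Iso D₁ D₃ ⊎ Iso D₂ D₃
  two-isomorphic D₁ D₂ D₃ opt₁ opt₂ opt₃
    with optimal⇒shape D₁ opt₁ | optimal⇒shape D₂ opt₂ | optimal⇒shape D₃ opt₃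
  ... | k₁ , c₁ , S₁ | k₂ , c₂ , S₂ | k₃ , c₃ , S₃ with pigeonhole₃ c₁ c₂ c₃
  ...   | inj₁ refl = inj₁ (same-shape⇒iso S₁ S₂)
  ...   | inj₂ (inj₁ refl) = inj₂ (inj₁ (same-shape⇒iso S₁ S₃))
  ...   | inj₂ (inj₂ refl) = inj₂ (inj₂ (same-shape⇒iso S₂ S₃))

corollary2p4 : (p q : ℕ) → 4 ≤ p → q ≤ p C (p / 2) → 1 + (p ∸ 1) C ((p ∸ 1) / 2) < q →
    ((D : Digraph p q) → Optimal D → HasDiam D 2 →
      (Σ (Fin 2) λ i → Pattern D i × (∀ j → Pattern D j → j ≡ i)) ×
      (∀ (b c : Fin q) → b ≢ c → Independent (OutV2 D b) (OutV2 D c))) ×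
    (q ≡ p C (p / 2) → (D₁ D₂ D₃ : Digraph p q) → Optimal D₁ → Optimal D₂ → Optimal D₃ →
      Iso D₁ D₂ ⊎ Iso D₁ D₃ ⊎ Iso D₂ D₃)
corollary2p4 p q 4≤p _ N+1<q =
  (λ D opt diam → diameter₂-structure p q 4≤p N+1<q′ D (proj₁ opt) (proj₁ diam)) , central-case
  where
  N+1<q′ : 1 + (p ∸ 1) C ⌊ p ∸ 1 /2⌋ < q
  N+1<q′ = subst (λ m → 1 + (p ∸ 1) C m < q) (/2≡⌊/2⌋ (p ∸ 1)) N+1<q
  central-case : q ≡ p C (p / 2) → (D₁ D₂ D₃ : Digraph p q) → Optimal D₁ → Optimal D₂ → Optimal D₃ →
    Iso D₁ D₂ ⊎ Iso D₁ D₃ ⊎ Iso D₂ D₃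
  central-case q≡ with trans q≡ (cong (p C_) (/2≡⌊/2⌋ p))
  ... | refl = CentralCase.two-isomorphic p 4≤p N+1<q′
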